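{- For odd integers $r,t\ge1$, $$(r-1)!\,h[-r]h[-1]^t\mathbf{1}=\sum_{n\ge0}\sum_{k\ge0}\binom{t}{2k}\frac{n!\,S_r^{(n+1)}(2k)!}{k!(-24)^k}\,h(-n-1)h(-1)^{t-2k}\mathbf{1}-\sum_{k\ge0}\binom{t}{2k+1}\frac{B_{r+1}(2k+1)!}{k!(r+1)(-24)^k}\,h(-1)^{t-2k-1}\mathbf{1},$$ where $S_r^{(n+1)}=\frac1{n!}\sum_{j\ge0}\binom{n}{j}(-1)^{n+j}(j+1)^{r-1}$ (Stirling numbers of the second kind) and $B_m$ are the Bernoulli numbers.
   Context: $S_{\mathrm{alg}}=\mathbb{Q}[h(-1),h(-2),\dots]$ (any field of characteristic zero) is the rank-one Heisenberg vertex operator algebra with vacuum $\mathbf{1}=1$: for $n<0$, $h(n)$ acts by multiplication, for $n\ge1$, $h(n)$ acts as $n\,\partial/\partial h(-n)$, and $h(0)$ acts as $0$. The square-bracket modes are $h[n]=\mathrm{Res}_z\, z^n e^z\sum_{m\in\mathbb{Z}}h(m)(e^z-1)^{ -m-1}$, with $(e^z-1)^{ -m-1}$ expanded as a Laurent series in $z$ (only finitely many $h(m)$, $m\ge0$, act nontrivially on a given state). -}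

module Defs where

open import Data.Nat as ℕ using (ℕ; zero; suc; _≡ᵇ_; _⊔_; _!)
open import Data.Nat.Properties using (_!≢0)
open import Data.Nat.Combinatorics using (_C_)
open import Data.Integer as ℤ using (ℤ; +_; -[1+_])
open import Data.Rational as ℚ using (ℚ; 0ℚ; 1ℚ; _/_)
open import Data.Bool using (Bool; true; false; _∧_)
open import Data.List using (List; []; _∷_; _++_; map; length)
open import Data.Product using (_×_; _,_)
open import Relation.Binary.PropositionalEquality using (_≡_)

toQ : ℕ → ℚ
toQ n = + n / 1

invFact : ℕ → ℚ
invFact n = + 1 / (n !)
  where instance _ = n !≢0

powQ : ℚ → ℕ → ℚ
powQ q zero    = 1ℚ
powQ q (suc n) = q ℚ.* powQ q n

sumTo : ℕ → (ℕ → ℚ) → ℚ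
sumTo zero    f = f 0
sumTo (suc k) f = sumTo k f ℚ.+ f (suc k)

-- The Heisenberg VOA  S_alg = ℚ[h(-1), h(-2), ...]
-- A monomial is the list of exponents (e₀, e₁, ...) where eᵢ is the
-- exponent of h(-(i+1)); missing trailing entries mean exponent 0.
-- A state is a finite formal sum of terms (coefficient, monomial).

Mono : Set
Mono = List ℕ

State : Set
State = List (ℚ × Mono)

monoEq : Mono → Mono → Bool
monoEq []       []       = true
monoEq []       (b ∷ bs) = (b ≡ᵇ 0) ∧ monoEq [] bs
monoEq (a ∷ as) []       = (a ≡ᵇ 0) ∧ monoEq as []
monoEq (a ∷ as) (b ∷ bs) = (a ≡ᵇ b) ∧ monoEq as bs

coeff : State → Mono → ℚ
coeff []             m = 0ℚ
coeff ((c , e) ∷ v) m with monoEq e m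
... | true  = c ℚ.+ coeff v m
... | false = coeff v m

infix 4 _≈_
_≈_ : State → State → Set
v ≈ w = ∀ (m : Mono) → coeff v m ≡ coeff w m

vac : State
vac = (1ℚ , []) ∷ []

infixl 6 _+S_
_+S_ : State → State → State
v +S w = v ++ w

scaleS : ℚ → State → State
scaleS q v = map (λ { (c , e) → (q ℚ.* c , e) }) v

negS : State → State
negS = scaleS (ℚ.- 1ℚ)

zeroS : State
zeroS = []

sumSt : ℕ → (ℕ → State) → State
sumSt zero    f = f 0
sumSt (suc k) f = sumSt k f +S f (suc k)

expAt : ℕ → Mono → ℕ
expAt i       []       = 0
expAt zero    (e ∷ es) = e
expAt (suc i) (e ∷ es) = expAt i es

incAt : ℕ → Mono → Mono
incAt zero    []       = 1 ∷ []
incAt zero    (e ∷ es) = suc e ∷ es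
incAt (suc i) []       = 0 ∷ incAt i []
incAt (suc i) (e ∷ es) = e ∷ incAt i es

decAt : ℕ → Mono → Mono
decAt i       []       = []
decAt zero    (e ∷ es) = e ℕ.∸ 1 ∷ es
decAt (suc i) (e ∷ es) = e ∷ decAt i es

-- the modes h(m), m ∈ ℤ :
--   h(-(i+1)) = multiplication by h(-(i+1)),
--   h(0) = 0,
--   h(i+1) = (i+1) ∂/∂h(-(i+1)).
hmode : ℤ → State → State
hmode (+ zero)  v = zeroS
hmode (+ suc i) v =
  map (λ { (c , e) → (toQ (suc i) ℚ.* toQ (expAt i e) ℚ.* c , decAt i e) }) v
hmode -[1+ i ]  v = map (λ { (c , e) → (c , incAt i e) }) v

-- Formal power series (coefficient functions) and the Laurent expansion
-- of (e^z - 1)^{-m-1} = z^{-m-1} g(z)^{-m-1},  g(z) = (e^z - 1)/z.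

Ser : Set
Ser = ℕ → ℚ

oneSer : Ser
oneSer zero    = 1ℚ
oneSer (suc _) = 0ℚ

mulSer : Ser → Ser → Ser
mulSer f g k = sumTo k (λ i → f i ℚ.* g (k ℕ.∸ i))

powSer : Ser → ℕ → Ser
powSer f zero    = oneSer
powSer f (suc n) = mulSer f (powSer f n)

-- multiplicative inverse of a series with constant term 1:
-- 1/f = Σ_j (1 - f)^j, and only j ≤ k contributes to z^k.
invSer : Ser → Ser
invSer f k = sumTo k (λ j → powSer (λ i → oneSer i ℚ.- f i) j k)

powSerℤ : Ser → ℤ → Ser
powSerℤ f (+ n)    = powSer f n
powSerℤ f -[1+ n ] = powSer (invSer f) (suc n)

expSer : Ser
expSer k = invFact k

-- g(z) = (e^z - 1)/z = Σ z^k/(k+1)!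
gSer : Ser
gSer k = invFact (suc k)

-- Res_z z^n e^z (e^z - 1)^{-m-1}
--   = [z^{m-n}] ( e^z g(z)^{-m-1} )   (zero if m < n)
bracketCoeff : ℤ → ℤ → ℚ
bracketCoeff n m with m ℤ.- n
... | + d      = mulSer expSer (powSerℤ gSer (ℤ.- (ℤ.suc m))) d
... | -[1+ _ ] = 0ℚ

maxLen : State → ℕ
maxLen []            = 0
maxLen ((_ , e) ∷ v) = length e ⊔ maxLen v

-- h[n] v = Σ_{m ≥ n} bracketCoeff n m · h(m) v.
-- For m > maxLen v we have h(m) v = 0, so summing m from n to
-- n + (|n| + maxLen v + 1) gives exactly the (finite) formal sum.
hbracket : ℤ → State → State
hbracket n v =
  sumSt (ℤ.∣ n ∣ ℕ.+ maxLen v ℕ.+ 1)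
        (λ d → scaleS (bracketCoeff n (n ℤ.+ + d)) (hmode (n ℤ.+ + d) v))

iterS : ℕ → (State → State) → State → State
iterS zero    f v = v
iterS (suc k) f v = f (iterS k f v)

-- Bernoulli numbers: B₀ = 1, Σ_{j=0}^{m} C(m+1,j) B_j = 0 for m ≥ 1.

at : List ℚ → ℕ → ℚ
at []       _       = 0ℚ
at (x ∷ xs) zero    = x
at (x ∷ xs) (suc i) = at xs i

bernList : ℕ → List ℚ
bernList zero    = 1ℚ ∷ []
bernList (suc m) =
  bs ++ ((ℚ.- (+ 1 / suc (suc m))) ℚ.* sumTo m (λ j → toQ (suc (suc m) C j) ℚ.* at bs j) ∷ [])
  where bs = bernList m

bernoulli : ℕ → ℚ
bernoulli m = at (bernList m) m

stirling : ℕ → ℕ → ℚ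
stirling r n =
  invFact n ℚ.* sumTo n (λ j → toQ (n C j) ℚ.* powQ (ℚ.- 1ℚ) (n ℕ.+ j)
                                   ℚ.* toQ (suc j ℕ.^ (r ℕ.∸ 1)))

{-# OPTIONS --safe #-}
-- On polynomials in h(-1) only the modes h(m), m ≤ 1, act, and there h[-1] = h(-1) - (1/12) h(1); a
-- Hermite-type recursion then gives h[-1]^t 1 = Σ_k C(t,2k) (2k)!/(k! (-24)^k) h(-1)^(t-2k) 1.  On the same
-- states h[-r] = Σ_{n<r} c_n h(-n-1) + c h(1) with c_n = [z^(r-1-n)] e^z g^n and c = [z^(r+1)] e^z g^(-2),
-- where g = (e^z - 1)/z.  Since z^n e^z g^n = e^z (e^z - 1)^n = Σ_j C(n,j) (-1)^(n+j) e^((j+1)z), the number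
-- (r-1)! c_n is n! S_r^(n+1).  Since 1/g = β is the generating function of B_k/k!, and differentiating β g = 1
-- gives e^z β² = β - zβ', one gets (r-1)! c = -B_(r+1)/(r+1).
module Submission where

open import Defs
open import Data.Nat as ℕ using (ℕ; zero; suc; _≤_; _<_; z≤n; s≤s; _∸_; _^_; _!)
import Data.Nat.Properties as ℕₚ
open import Data.Nat.Combinatorics using (_C_)
open import Data.Integer as ℤ using (-[1+_])
import Data.Integer.Properties as ℤₚ
open import Data.Rational using (ℚ; 0ℚ; 1ℚ; _/_)
open import Relation.Binary.PropositionalEquality
open import Tactic.RingSolver using (solve-∀)

module RationalNumerals where

  open import Data.Nat.Properties using (_!≢0; _!*_!≢0)
  open import Data.Nat.Combinatorics using (k![n∸k]!∣n!)
  open import Data.Nat.Combinatorics.Specification using (nCk≡n!/k![n-k]!)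
  open import Data.Nat.DivMod using (m/n*n≡m)
  open import Data.Integer using (+_)
  open import Data.Integer.Properties using (pos-+; pos-*)
  open import Data.Integer.Tactic.RingSolver renaming (solve-∀ to ℤ-solve-∀)
  open import Data.Rational using (_≟_; _+_; _*_; toℚᵘ)
  open import Data.Rational.Properties using (+-*-commutativeRing; toℚᵘ-injective; toℚᵘ-fromℚᵘ; toℚᵘ-homo-+; toℚᵘ-homo-*; *-identityʳ; *-assoc; *-comm)
  open import Data.Rational.Unnormalised using (mkℚᵘ; *≡*) renaming (_≃_ to _≃ᵘ_)
  open import Data.Rational.Unnormalised.Properties as ℚᵘₚ using (≃-trans; ≃-sym)
  open import Relation.Nullary.Decidable.Core using (dec⇒maybe)
  open import Level using (0ℓ)
  open import Tactic.RingSolver.Core.AlmostCommutativeRing using (AlmostCommutativeRing; fromCommutativeRing)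

  ℚ-ring : AlmostCommutativeRing 0ℓ 0ℓ
  ℚ-ring = fromCommutativeRing +-*-commutativeRing (λ x → dec⇒maybe (0ℚ ≟ x))

  toℚᵘ-toQ : ∀ n → toℚᵘ (toQ n) ≃ᵘ mkℚᵘ (+ n) 0
  toℚᵘ-toQ n = toℚᵘ-fromℚᵘ (mkℚᵘ (+ n) 0)

  toQ-+ : ∀ m n → toQ (m ℕ.+ n) ≡ toQ m + toQ n
  toQ-+ m n = toℚᵘ-injective (≃-trans (toℚᵘ-toQ (m ℕ.+ n)) (≃-sym (≃-trans (toℚᵘ-homo-+ (toQ m) (toQ n))
    (≃-trans (ℚᵘₚ.+-cong (toℚᵘ-toQ m) (toℚᵘ-toQ n))
    (*≡* (trans (shape (+ m) (+ n)) (cong (ℤ._* (+ 1 ℤ.* + 1)) (sym (pos-+ m n)))))))))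
    where
    shape : ∀ a b → (a ℤ.* + 1 ℤ.+ b ℤ.* + 1) ℤ.* + 1 ≡ (a ℤ.+ b) ℤ.* (+ 1 ℤ.* + 1)
    shape = ℤ-solve-∀

  toQ-* : ∀ m n → toQ (m ℕ.* n) ≡ toQ m * toQ n
  toQ-* m n = toℚᵘ-injective (≃-trans (toℚᵘ-toQ (m ℕ.* n)) (≃-sym (≃-trans (toℚᵘ-homo-* (toQ m) (toQ n))
    (≃-trans (ℚᵘₚ.*-cong (toℚᵘ-toQ m) (toℚᵘ-toQ n))
    (*≡* (trans (shape (+ m) (+ n)) (cong (ℤ._* (+ 1 ℤ.* + 1)) (sym (pos-* m n)))))))))
    where
    shape : ∀ a b → (a ℤ.* b) ℤ.* + 1 ≡ (a ℤ.* b) ℤ.* (+ 1 ℤ.* + 1)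
    shape = ℤ-solve-∀

  1/n*n≡1 : ∀ n .{{_ : ℕ.NonZero n}} → (+ 1 / n) * toQ n ≡ 1ℚ
  1/n*n≡1 (suc n) = toℚᵘ-injective (≃-trans (toℚᵘ-homo-* (+ 1 / suc n) (toQ (suc n)))
    (≃-trans (ℚᵘₚ.*-cong (toℚᵘ-fromℚᵘ (mkℚᵘ (+ 1) n)) (toℚᵘ-toQ (suc n))) (*≡* (shape (+ suc n)))))
    where
    shape : ∀ a → (+ 1 ℤ.* a) ℤ.* + 1 ≡ + 1 ℤ.* (a ℤ.* + 1)
    shape = ℤ-solve-∀

  *-cancelʳ-toQ : ∀ n .{{_ : ℕ.NonZero n}} {x y} → x * toQ n ≡ y * toQ n → x ≡ y
  *-cancelʳ-toQ n {x} {y} eq = begin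
    x                      ≡⟨ unscale x ⟨
    x * toQ n * (+ 1 / n)  ≡⟨ cong (_* (+ 1 / n)) eq ⟩
    y * toQ n * (+ 1 / n)  ≡⟨ unscale y ⟩
    y                      ∎
    where
    open ≡-Reasoning
    reassoc : ∀ a b c → a * b * c ≡ a * (c * b)
    reassoc = solve-∀ ℚ-ring
    unscale : ∀ z → z * toQ n * (+ 1 / n) ≡ z
    unscale z = trans (reassoc z (toQ n) (+ 1 / n)) (trans (cong (z *_) (1/n*n≡1 n)) (*-identityʳ z))

  invFact*n!≡1 : ∀ n → invFact n * toQ (n !) ≡ 1ℚ
  invFact*n!≡1 n = 1/n*n≡1 (n !) {{n !≢0}}

  invFact-suc : ∀ n → invFact (suc n) * toQ (suc n) ≡ invFact n
  invFact-suc n = *-cancelʳ-toQ (n !) {{n !≢0}} (begin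
    invFact (suc n) * toQ (suc n) * toQ (n !)    ≡⟨ *-assoc (invFact (suc n)) (toQ (suc n)) (toQ (n !)) ⟩
    invFact (suc n) * (toQ (suc n) * toQ (n !))  ≡⟨ cong (invFact (suc n) *_) (toQ-* (suc n) (n !)) ⟨
    invFact (suc n) * toQ (suc n !)              ≡⟨ invFact*n!≡1 (suc n) ⟩
    1ℚ                                           ≡⟨ invFact*n!≡1 n ⟨
    invFact n * toQ (n !)                        ∎)
    where open ≡-Reasoning

  nCk*k![n∸k]!≡n! : ∀ {n k} → k ≤ n → (n C k) ℕ.* (k ! ℕ.* (n ∸ k) !) ≡ n !
  nCk*k![n∸k]!≡n! {n} {k} k≤n = trans (cong (ℕ._* (k ! ℕ.* (n ∸ k) !)) (nCk≡n!/k![n-k]! k≤n))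
    (m/n*n≡m {{k !* (n ∸ k) !≢0}} (k![n∸k]!∣n! k≤n))

  invFact-binomial : ∀ {n j} → j ≤ n → invFact j * invFact (n ∸ j) ≡ toQ (n C j) * invFact n
  invFact-binomial {n} {j} j≤n = *-cancelʳ-toQ (j ! ℕ.* (n ∸ j) !) {{j !* (n ∸ j) !≢0}} (begin
    invFact j * invFact (n ∸ j) * toQ (j ! ℕ.* (n ∸ j) !)
      ≡⟨ cong (invFact j * invFact (n ∸ j) *_) (toQ-* (j !) ((n ∸ j) !)) ⟩
    invFact j * invFact (n ∸ j) * (toQ (j !) * toQ ((n ∸ j) !))
      ≡⟨ regroup (invFact j) (invFact (n ∸ j)) (toQ (j !)) (toQ ((n ∸ j) !)) ⟩
    (invFact j * toQ (j !)) * (invFact (n ∸ j) * toQ ((n ∸ j) !))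
      ≡⟨ cong₂ _*_ (invFact*n!≡1 j) (invFact*n!≡1 (n ∸ j)) ⟩
    1ℚ
      ≡⟨ invFact*n!≡1 n ⟨
    invFact n * toQ (n !)
      ≡⟨ cong (λ m → invFact n * toQ m) (nCk*k![n∸k]!≡n! j≤n) ⟨
    invFact n * toQ ((n C j) ℕ.* (j ! ℕ.* (n ∸ j) !))
      ≡⟨ cong (invFact n *_) (toQ-* (n C j) (j ! ℕ.* (n ∸ j) !)) ⟩
    invFact n * (toQ (n C j) * toQ (j ! ℕ.* (n ∸ j) !))
      ≡⟨ *-assoc-swap (invFact n) (toQ (n C j)) (toQ (j ! ℕ.* (n ∸ j) !)) ⟩
    toQ (n C j) * invFact n * toQ (j ! ℕ.* (n ∸ j) !) ∎)
    where
    open ≡-Reasoning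
    regroup : ∀ a b c d → a * b * (c * d) ≡ (a * c) * (b * d)
    regroup = solve-∀ ℚ-ring
    *-assoc-swap : ∀ a b c → a * (b * c) ≡ b * a * c
    *-assoc-swap = solve-∀ ℚ-ring

  invFact-suc*n!≡1/[1+n] : ∀ n → invFact (suc n) * toQ (n !) ≡ + 1 / suc n
  invFact-suc*n!≡1/[1+n] n = *-cancelʳ-toQ (suc n) (begin
    invFact (suc n) * toQ (n !) * toQ (suc n)    ≡⟨ *-assoc (invFact (suc n)) (toQ (n !)) (toQ (suc n)) ⟩
    invFact (suc n) * (toQ (n !) * toQ (suc n))  ≡⟨ cong (invFact (suc n) *_) (trans (*-comm (toQ (n !)) (toQ (suc n))) (sym (toQ-* (suc n) (n !)))) ⟩
    invFact (suc n) * toQ (suc n !)              ≡⟨ invFact*n!≡1 (suc n) ⟩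
    1ℚ                                           ≡⟨ 1/n*n≡1 (suc n) ⟨
    + 1 / suc n * toQ (suc n)                    ∎)
    where open ≡-Reasoning

module FiniteSums where

  open RationalNumerals
  open import Data.Rational using (_+_; _*_; -_; _-_)
  open import Data.Rational.Properties using (*-distribˡ-+; *-comm; neg-distrib-+; +-assoc; +-comm; +-identityʳ)

  sumTo-cong-≤ : ∀ k {f g : ℕ → ℚ} → (∀ i → i ≤ k → f i ≡ g i) → sumTo k f ≡ sumTo k g
  sumTo-cong-≤ zero    f≡g = f≡g 0 z≤n
  sumTo-cong-≤ (suc k) f≡g = cong₂ _+_ (sumTo-cong-≤ k (λ i i≤k → f≡g i (ℕₚ.m≤n⇒m≤1+n i≤k))) (f≡g (suc k) ℕₚ.≤-refl)

  sumTo-cong : ∀ k {f g : ℕ → ℚ} → (∀ i → f i ≡ g i) → sumTo k f ≡ sumTo k g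
  sumTo-cong k f≡g = sumTo-cong-≤ k (λ i _ → f≡g i)

  sumTo-zero : ∀ k (f : ℕ → ℚ) → (∀ i → i ≤ k → f i ≡ 0ℚ) → sumTo k f ≡ 0ℚ
  sumTo-zero zero    f f≡0 = f≡0 0 z≤n
  sumTo-zero (suc k) f f≡0 = cong₂ _+_ (sumTo-zero k f (λ i i≤k → f≡0 i (ℕₚ.m≤n⇒m≤1+n i≤k))) (f≡0 (suc k) ℕₚ.≤-refl)

  sumTo-+ : ∀ k (f g : ℕ → ℚ) → sumTo k (λ i → f i + g i) ≡ sumTo k f + sumTo k g
  sumTo-+ zero    f g = refl
  sumTo-+ (suc k) f g = trans (cong (_+ (f (suc k) + g (suc k))) (sumTo-+ k f g))
    (interchange (sumTo k f) (sumTo k g) (f (suc k)) (g (suc k)))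
    where
    interchange : ∀ a b c d → (a + b) + (c + d) ≡ (a + c) + (b + d)
    interchange = solve-∀ ℚ-ring

  sumTo-*ˡ : ∀ k c (f : ℕ → ℚ) → sumTo k (λ i → c * f i) ≡ c * sumTo k f
  sumTo-*ˡ zero    c f = refl
  sumTo-*ˡ (suc k) c f = trans (cong (_+ (c * f (suc k))) (sumTo-*ˡ k c f)) (sym (*-distribˡ-+ c _ _))

  sumTo-*ʳ : ∀ k c (f : ℕ → ℚ) → sumTo k (λ i → f i * c) ≡ sumTo k f * c
  sumTo-*ʳ k c f = trans (sumTo-cong k (λ i → *-comm (f i) c)) (trans (sumTo-*ˡ k c f) (*-comm c _))

  sumTo-neg : ∀ k (f : ℕ → ℚ) → sumTo k (λ i → - f i) ≡ - sumTo k f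
  sumTo-neg zero    f = refl
  sumTo-neg (suc k) f = trans (cong (_+ (- f (suc k))) (sumTo-neg k f)) (sym (neg-distrib-+ (sumTo k f) (f (suc k))))

  sumTo-sucˡ : ∀ k (f : ℕ → ℚ) → sumTo (suc k) f ≡ f 0 + sumTo k (λ i → f (suc i))
  sumTo-sucˡ zero    f = refl
  sumTo-sucˡ (suc k) f = trans (cong (_+ f (suc (suc k))) (sumTo-sucˡ k f)) (+-assoc (f 0) _ _)

  sumTo-reverse : ∀ k (f : ℕ → ℚ) → sumTo k f ≡ sumTo k (λ i → f (k ∸ i))
  sumTo-reverse zero    f = refl
  sumTo-reverse (suc k) f = begin
    sumTo k f + f (suc k)                  ≡⟨ cong (_+ f (suc k)) (sumTo-reverse k f) ⟩
    sumTo k (λ i → f (k ∸ i)) + f (suc k)  ≡⟨ +-comm (sumTo k (λ i → f (k ∸ i))) (f (suc k)) ⟩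
    f (suc k) + sumTo k (λ i → f (k ∸ i))  ≡⟨ sumTo-sucˡ k (λ i → f (suc k ∸ i)) ⟨
    sumTo (suc k) (λ i → f (suc k ∸ i))    ∎
    where open ≡-Reasoning

  sumTo-comm : ∀ a b (f : ℕ → ℕ → ℚ) →
               sumTo a (λ i → sumTo b (λ j → f i j)) ≡ sumTo b (λ j → sumTo a (λ i → f i j))
  sumTo-comm zero    b f = refl
  sumTo-comm (suc a) b f =
    trans (cong (_+ sumTo b (λ j → f (suc a) j)) (sumTo-comm a b f)) (sym (sumTo-+ b _ _))

  sumTo-triangle : ∀ k (F : ℕ → ℕ → ℚ) →
                   sumTo k (λ i → sumTo i (λ j → F j i)) ≡ sumTo k (λ j → sumTo (k ∸ j) (λ i → F j (j ℕ.+ i)))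
  sumTo-triangle zero    F = refl
  sumTo-triangle (suc k) F = begin
    sumTo k (λ i → sumTo i (λ j → F j i)) + (sumTo k (λ j → F j (suc k)) + F (suc k) (suc k))
      ≡⟨ cong (_+ (sumTo k (λ j → F j (suc k)) + F (suc k) (suc k))) (sumTo-triangle k F) ⟩
    rows k + (sumTo k (λ j → F j (suc k)) + F (suc k) (suc k))
      ≡⟨ +-assoc (rows k) (sumTo k (λ j → F j (suc k))) (F (suc k) (suc k)) ⟨
    (rows k + sumTo k (λ j → F j (suc k))) + F (suc k) (suc k)
      ≡⟨ cong₂ _+_ (trans (sym (sumTo-+ k _ _)) (sumTo-cong-≤ k extend-row)) last-row ⟩
    sumTo k (λ j → sumTo (suc k ∸ j) (λ i → F j (j ℕ.+ i))) + sumTo (k ∸ k) (λ i → F (suc k) (suc k ℕ.+ i)) ∎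
    where
    open ≡-Reasoning
    rows : ℕ → ℚ
    rows k = sumTo k (λ j → sumTo (k ∸ j) (λ i → F j (j ℕ.+ i)))
    extend-row : ∀ j → j ≤ k → sumTo (k ∸ j) (λ i → F j (j ℕ.+ i)) + F j (suc k) ≡ sumTo (suc k ∸ j) (λ i → F j (j ℕ.+ i))
    extend-row j j≤k rewrite ℕₚ.+-∸-assoc 1 j≤k =
      cong (λ m → sumTo (k ∸ j) (λ i → F j (j ℕ.+ i)) + F j m) (sym (trans (ℕₚ.+-suc j (k ∸ j)) (cong suc (ℕₚ.m+[n∸m]≡n j≤k))))
    last-row : F (suc k) (suc k) ≡ sumTo (k ∸ k) (λ i → F (suc k) (suc k ℕ.+ i))
    last-row rewrite ℕₚ.n∸n≡0 k | ℕₚ.+-identityʳ k = refl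

  sumTo-extend : ∀ k m (f : ℕ → ℚ) → k ≤ m → (∀ i → k < i → f i ≡ 0ℚ) → sumTo m f ≡ sumTo k f
  sumTo-extend k m f k≤m f≡0 = trans (cong (λ n → sumTo n f) (sym (ℕₚ.m∸n+n≡m k≤m))) (pad (m ∸ k))
    where
    pad : ∀ d → sumTo (d ℕ.+ k) f ≡ sumTo k f
    pad zero    = refl
    pad (suc d) = trans (cong₂ _+_ (pad d) (f≡0 (suc (d ℕ.+ k)) (s≤s (ℕₚ.m≤n+m k d)))) (+-identityʳ _)

  sumTo-telescope : ∀ k (a : ℕ → ℚ) → sumTo k (λ j → a j - a (suc j)) ≡ a 0 - a (suc k)
  sumTo-telescope zero    a = refl
  sumTo-telescope (suc k) a = trans (cong (_+ (a (suc k) - a (suc (suc k)))) (sumTo-telescope k a))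
    (cancel (a 0) (a (suc k)) (a (suc (suc k))))
    where
    cancel : ∀ x y z → (x - y) + (y - z) ≡ x - z
    cancel = solve-∀ ℚ-ring

module PowerSeries where

  open RationalNumerals
  open FiniteSums
  open import Data.Rational using (_+_; _*_; -_; _-_)
  open import Data.Rational.Properties
  open import Relation.Binary.Bundles using (Setoid)
  import Relation.Binary.Reasoning.Setoid as SetoidReasoning

  module ≗ = Setoid (ℕ →-setoid ℚ)
  module ≗-Reasoning = SetoidReasoning (ℕ →-setoid ℚ)

  addSer : Ser → Ser → Ser
  addSer f g k = f k + g k

  scaleSer : ℚ → Ser → Ser
  scaleSer c f k = c * f k

  shiftSer : Ser → Ser
  shiftSer f zero    = 0ℚ
  shiftSer f (suc k) = f k

  θ : Ser → Ser
  θ f k = toQ k * f k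

  mulSer-cong : ∀ {f f′ g g′} → f ≗ f′ → g ≗ g′ → mulSer f g ≗ mulSer f′ g′
  mulSer-cong f≗f′ g≗g′ k = sumTo-cong k (λ i → cong₂ _*_ (f≗f′ i) (g≗g′ (k ∸ i)))

  mulSer-congˡ : ∀ f {g g′} → g ≗ g′ → mulSer f g ≗ mulSer f g′
  mulSer-congˡ f = mulSer-cong {f} ≗.refl

  mulSer-congʳ : ∀ g {f f′} → f ≗ f′ → mulSer f g ≗ mulSer f′ g
  mulSer-congʳ g f≗f′ = mulSer-cong f≗f′ (≗.refl {g})

  mulSer-comm : ∀ f g → mulSer f g ≗ mulSer g f
  mulSer-comm f g k = trans (sumTo-reverse k (λ i → f i * g (k ∸ i)))
    (sumTo-cong-≤ k (λ i i≤k → trans (*-comm (f (k ∸ i)) (g (k ∸ (k ∸ i))))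
                                     (cong (λ j → g j * f (k ∸ i)) (ℕₚ.m∸[m∸n]≡n i≤k))))

  mulSer-assoc : ∀ f g h → mulSer (mulSer f g) h ≗ mulSer f (mulSer g h)
  mulSer-assoc f g h k = begin
    sumTo k (λ i → sumTo i (λ j → f j * g (i ∸ j)) * h (k ∸ i))
      ≡⟨ sumTo-cong k (λ i → sym (sumTo-*ʳ i (h (k ∸ i)) (λ j → f j * g (i ∸ j)))) ⟩
    sumTo k (λ i → sumTo i (λ j → f j * g (i ∸ j) * h (k ∸ i)))
      ≡⟨ sumTo-triangle k (λ j i → f j * g (i ∸ j) * h (k ∸ i)) ⟩
    sumTo k (λ j → sumTo (k ∸ j) (λ i → f j * g ((j ℕ.+ i) ∸ j) * h (k ∸ (j ℕ.+ i))))
      ≡⟨ sumTo-cong k (λ j → trans (sumTo-cong (k ∸ j) (reindex j)) (sumTo-*ˡ (k ∸ j) (f j) (λ i → g i * h ((k ∸ j) ∸ i)))) ⟩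
    sumTo k (λ j → f j * sumTo (k ∸ j) (λ i → g i * h ((k ∸ j) ∸ i))) ∎
    where
    open ≡-Reasoning
    reindex : ∀ j i → f j * g ((j ℕ.+ i) ∸ j) * h (k ∸ (j ℕ.+ i)) ≡ f j * (g i * h ((k ∸ j) ∸ i))
    reindex j i rewrite ℕₚ.m+n∸m≡n j i | sym (ℕₚ.∸-+-assoc k j i) = *-assoc (f j) (g i) (h (k ∸ j ∸ i))

  mulSer-distribˡ : ∀ f g h → mulSer f (addSer g h) ≗ addSer (mulSer f g) (mulSer f h)
  mulSer-distribˡ f g h k = trans (sumTo-cong k (λ i → *-distribˡ-+ (f i) (g (k ∸ i)) (h (k ∸ i))))
    (sumTo-+ k (λ i → f i * g (k ∸ i)) (λ i → f i * h (k ∸ i)))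

  mulSer-distribʳ : ∀ f g h → mulSer (addSer g h) f ≗ addSer (mulSer g f) (mulSer h f)
  mulSer-distribʳ f g h k = begin
    mulSer (addSer g h) f k             ≡⟨ mulSer-comm (addSer g h) f k ⟩
    mulSer f (addSer g h) k             ≡⟨ mulSer-distribˡ f g h k ⟩
    mulSer f g k + mulSer f h k         ≡⟨ cong₂ _+_ (mulSer-comm f g k) (mulSer-comm f h k) ⟩
    mulSer g f k + mulSer h f k         ∎
    where open ≡-Reasoning

  mulSer-scaleʳ : ∀ c f g → mulSer f (scaleSer c g) ≗ scaleSer c (mulSer f g)
  mulSer-scaleʳ c f g k =
    trans (sumTo-cong k (λ i → swap (f i) c (g (k ∸ i)))) (sumTo-*ˡ k c (λ i → f i * g (k ∸ i)))
    where
    swap : ∀ a b d → a * (b * d) ≡ b * (a * d)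
    swap = solve-∀ ℚ-ring

  mulSer-scaleˡ : ∀ c f g → mulSer (scaleSer c f) g ≗ scaleSer c (mulSer f g)
  mulSer-scaleˡ c f g k = begin
    mulSer (scaleSer c f) g k   ≡⟨ mulSer-comm (scaleSer c f) g k ⟩
    mulSer g (scaleSer c f) k   ≡⟨ mulSer-scaleʳ c g f k ⟩
    c * mulSer g f k            ≡⟨ cong (c *_) (mulSer-comm g f k) ⟩
    c * mulSer f g k            ∎
    where open ≡-Reasoning

  mulSer-identityˡ : ∀ f → mulSer oneSer f ≗ f
  mulSer-identityˡ f zero    = *-identityˡ (f 0)
  mulSer-identityˡ f (suc k) = begin
    sumTo (suc k) (λ i → oneSer i * f (suc k ∸ i))
      ≡⟨ sumTo-sucˡ k (λ i → oneSer i * f (suc k ∸ i)) ⟩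
    1ℚ * f (suc k) + sumTo k (λ i → 0ℚ * f (k ∸ i))
      ≡⟨ cong₂ _+_ (*-identityˡ (f (suc k))) (sumTo-zero k _ (λ i _ → *-zeroˡ (f (k ∸ i)))) ⟩
    f (suc k) + 0ℚ
      ≡⟨ +-identityʳ (f (suc k)) ⟩
    f (suc k) ∎
    where open ≡-Reasoning

  mulSer-identityʳ : ∀ f → mulSer f oneSer ≗ f
  mulSer-identityʳ f k = trans (mulSer-comm f oneSer k) (mulSer-identityˡ f k)

  mulSer-shiftˡ : ∀ f g → mulSer (shiftSer f) g ≗ shiftSer (mulSer f g)
  mulSer-shiftˡ f g zero    = *-zeroˡ (g 0)
  mulSer-shiftˡ f g (suc k) = trans (sumTo-sucˡ k (λ i → shiftSer f i * g (suc k ∸ i)))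
    (trans (cong (_+ mulSer f g k) (*-zeroˡ (g (suc k)))) (+-identityˡ (mulSer f g k)))

  mulSer-shiftʳ : ∀ f g → mulSer g (shiftSer f) ≗ shiftSer (mulSer g f)
  mulSer-shiftʳ f g zero    = trans (mulSer-comm g (shiftSer f) 0) (mulSer-shiftˡ f g 0)
  mulSer-shiftʳ f g (suc k) =
    trans (mulSer-comm g (shiftSer f) (suc k)) (trans (mulSer-shiftˡ f g (suc k)) (mulSer-comm f g k))

  mulSer-sumˡ : ∀ n f (F : ℕ → Ser) → mulSer f (λ k → sumTo n (λ j → F j k)) ≗ (λ k → sumTo n (λ j → mulSer f (F j) k))
  mulSer-sumˡ n f F k = trans (sumTo-cong k (λ i → sym (sumTo-*ˡ n (f i) (λ j → F j (k ∸ i)))))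
    (sumTo-comm k n (λ i j → f i * F j (k ∸ i)))

  θ-mulSer : ∀ f g → θ (mulSer f g) ≗ addSer (mulSer (θ f) g) (mulSer f (θ g))
  θ-mulSer f g k = begin
    toQ k * sumTo k (λ i → f i * g (k ∸ i))
      ≡⟨ sumTo-*ˡ k (toQ k) (λ i → f i * g (k ∸ i)) ⟨
    sumTo k (λ i → toQ k * (f i * g (k ∸ i)))
      ≡⟨ sumTo-cong-≤ k split ⟩
    sumTo k (λ i → toQ i * f i * g (k ∸ i) + f i * (toQ (k ∸ i) * g (k ∸ i)))
      ≡⟨ sumTo-+ k (λ i → toQ i * f i * g (k ∸ i)) (λ i → f i * (toQ (k ∸ i) * g (k ∸ i))) ⟩
    addSer (mulSer (θ f) g) (mulSer f (θ g)) k ∎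
    where
    open ≡-Reasoning
    distrib : ∀ a b c d → (a + b) * (c * d) ≡ a * c * d + c * (b * d)
    distrib = solve-∀ ℚ-ring
    split : ∀ i → i ≤ k → toQ k * (f i * g (k ∸ i)) ≡ toQ i * f i * g (k ∸ i) + f i * (toQ (k ∸ i) * g (k ∸ i))
    split i i≤k = trans (cong (λ m → toQ m * (f i * g (k ∸ i))) (sym (ℕₚ.m+[n∸m]≡n i≤k)))
      (trans (cong (_* (f i * g (k ∸ i))) (toQ-+ i (k ∸ i))) (distrib (toQ i) (toQ (k ∸ i)) (f i) (g (k ∸ i))))

  powSer-vanishes-below : ∀ u → u 0 ≡ 0ℚ → ∀ j k → k < j → powSer u j k ≡ 0ℚ
  powSer-vanishes-below u u₀≡0 (suc j) k k<1+j = sumTo-zero k _ term≡0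
    where
    term≡0 : ∀ i → i ≤ k → u i * powSer u j (k ∸ i) ≡ 0ℚ
    term≡0 zero    _   = trans (cong (_* powSer u j k) u₀≡0) (*-zeroˡ (powSer u j k))
    term≡0 (suc i) i<k = trans (cong (u (suc i) *_) (powSer-vanishes-below u u₀≡0 j (k ∸ suc i) (shrink k i<k k<1+j)))
                               (*-zeroʳ (u (suc i)))
      where
      shrink : ∀ k → suc i ≤ k → k < suc j → k ∸ suc i < j
      shrink (suc k) _ (s≤s k<j) = ℕₚ.≤-trans (s≤s (ℕₚ.m∸n≤m k i)) k<j

  module _ (f : Ser) (f₀≡1 : f 0 ≡ 1ℚ) where

    private
      u : Ser
      u i = oneSer i - f i

      u₀≡0 : u 0 ≡ 0ℚ
      u₀≡0 = cong (λ x → 1ℚ - x) f₀≡1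

      partialInv : ℕ → Ser
      partialInv K k = sumTo K (λ j → powSer u j k)

      partialInv-stable : ∀ k K → k ≤ K → partialInv K k ≡ invSer f k
      partialInv-stable k K k≤K = sumTo-extend k K (λ j → powSer u j k) k≤K (λ j k<j → powSer-vanishes-below u u₀≡0 j k k<j)

      powSer-*-f : ∀ j → mulSer (powSer u j) f ≗ (λ k → powSer u j k - powSer u (suc j) k)
      powSer-*-f j k = begin
        mulSer (powSer u j) f k
          ≡⟨ mulSer-congˡ (powSer u j) f≡1-u k ⟩
        mulSer (powSer u j) (addSer oneSer (scaleSer (- 1ℚ) u)) k
          ≡⟨ mulSer-distribˡ (powSer u j) oneSer (scaleSer (- 1ℚ) u) k ⟩
        mulSer (powSer u j) oneSer k + mulSer (powSer u j) (scaleSer (- 1ℚ) u) k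
          ≡⟨ cong₂ _+_ (mulSer-identityʳ (powSer u j) k) (mulSer-scaleʳ (- 1ℚ) (powSer u j) u k) ⟩
        powSer u j k + - 1ℚ * mulSer (powSer u j) u k
          ≡⟨ cong (λ x → powSer u j k + - 1ℚ * x) (mulSer-comm (powSer u j) u k) ⟩
        powSer u j k + - 1ℚ * powSer u (suc j) k
          ≡⟨ minus (powSer u j k) (powSer u (suc j) k) ⟩
        powSer u j k - powSer u (suc j) k ∎
        where
        open ≡-Reasoning
        complement : ∀ a b → b ≡ a + - 1ℚ * (a - b)
        complement = solve-∀ ℚ-ring
        f≡1-u : f ≗ addSer oneSer (scaleSer (- 1ℚ) u)
        f≡1-u i = complement (oneSer i) (f i)
        minus : ∀ a b → a + - 1ℚ * b ≡ a - b
        minus = solve-∀ ℚ-ring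

    invSer-inverseˡ : mulSer (invSer f) f ≗ oneSer
    invSer-inverseˡ k = begin
      sumTo k (λ i → invSer f i * f (k ∸ i))
        ≡⟨ sumTo-cong-≤ k (λ i i≤k → cong (_* f (k ∸ i)) (sym (partialInv-stable i k i≤k))) ⟩
      mulSer (partialInv k) f k
        ≡⟨ mulSer-comm (partialInv k) f k ⟩
      mulSer f (λ i → sumTo k (λ j → powSer u j i)) k
        ≡⟨ mulSer-sumˡ k f (powSer u) k ⟩
      sumTo k (λ j → mulSer f (powSer u j) k)
        ≡⟨ sumTo-cong k (λ j → trans (mulSer-comm f (powSer u j) k) (powSer-*-f j k)) ⟩
      sumTo k (λ j → powSer u j k - powSer u (suc j) k)
        ≡⟨ sumTo-telescope k (λ j → powSer u j k) ⟩
      oneSer k - powSer u (suc k) k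
        ≡⟨ cong (λ x → oneSer k - x) (powSer-vanishes-below u u₀≡0 (suc k) k ℕₚ.≤-refl) ⟩
      oneSer k - 0ℚ
        ≡⟨ +-identityʳ (oneSer k) ⟩
      oneSer k ∎
      where open ≡-Reasoning

    invSer-unique : ∀ g → mulSer g f ≗ oneSer → invSer f ≗ g
    invSer-unique g gf≡1 = begin
      invSer f                         ≈⟨ mulSer-identityʳ (invSer f) ⟨
      mulSer (invSer f) oneSer         ≈⟨ mulSer-congˡ (invSer f) (λ k → trans (mulSer-comm f g k) (gf≡1 k)) ⟨
      mulSer (invSer f) (mulSer f g)   ≈⟨ mulSer-assoc (invSer f) f g ⟨
      mulSer (mulSer (invSer f) f) g   ≈⟨ mulSer-congʳ g invSer-inverseˡ ⟩
      mulSer oneSer g                  ≈⟨ mulSer-identityˡ g ⟩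
      g                                ∎
      where open ≗-Reasoning

  sumTo-shiftSer : ∀ N f → f N ≡ 0ℚ → sumTo N (shiftSer f) ≡ sumTo N f
  sumTo-shiftSer zero    f f₀≡0 = sym f₀≡0
  sumTo-shiftSer (suc N) f fN≡0 = begin
    sumTo (suc N) (shiftSer f)  ≡⟨ sumTo-sucˡ N (shiftSer f) ⟩
    0ℚ + sumTo N f              ≡⟨ +-identityˡ (sumTo N f) ⟩
    sumTo N f                   ≡⟨ +-identityʳ (sumTo N f) ⟨
    sumTo N f + 0ℚ              ≡⟨ cong (sumTo N f +_) fN≡0 ⟨
    sumTo (suc N) f             ∎
    where open ≡-Reasoning

module BernoulliSeries where

  open RationalNumerals
  open FiniteSums
  open PowerSeries
  open import Data.Nat.Combinatorics using (nCk≡nC[n∸k]; nC1≡n)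
  open import Data.Integer using (+_)
  open import Data.Rational using (_+_; _*_; -_; _-_)
  open import Data.Rational.Properties
  open import Data.List using (List; []; _∷_; _++_; length)
  open import Data.List.Properties using (length-++)
  open import Data.Sum using (inj₁; inj₂)

  at-++ˡ : ∀ (xs ys : List ℚ) i → i < length xs → at (xs ++ ys) i ≡ at xs i
  at-++ˡ (x ∷ xs) ys zero    _         = refl
  at-++ˡ (x ∷ xs) ys (suc i) (s≤s i<n) = at-++ˡ xs ys i i<n

  at-length : ∀ (xs : List ℚ) y → at (xs ++ y ∷ []) (length xs) ≡ y
  at-length []       y = refl
  at-length (x ∷ xs) y = at-length xs y

  length-bernList : ∀ m → length (bernList m) ≡ suc m
  length-bernList zero    = refl
  length-bernList (suc m) = trans (length-++ (bernList m)) (trans (cong (ℕ._+ 1) (length-bernList m)) (ℕₚ.+-comm (suc m) 1))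

  at-bernList : ∀ m j → j ≤ m → at (bernList m) j ≡ bernoulli j
  at-bernList zero    zero _   = refl
  at-bernList (suc m) j j≤1+m with ℕₚ.m≤n⇒m<n∨m≡n j≤1+m
  ... | inj₁ (s≤s j≤m) = trans (at-++ˡ (bernList m) _ j (subst (j <_) (sym (length-bernList m)) (s≤s j≤m)))
                               (at-bernList m j j≤m)
  ... | inj₂ refl      = refl

  bernoulli-recurrence : ∀ m → sumTo (suc m) (λ j → toQ (suc (suc m) C j) * bernoulli j) ≡ 0ℚ
  bernoulli-recurrence m = begin
    S + toQ (suc (suc m) C suc m) * bernoulli (suc m)
      ≡⟨ cong (λ c → S + toQ c * bernoulli (suc m)) [m+2]C[m+1]≡m+2 ⟩
    S + toQ (suc (suc m)) * bernoulli (suc m)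
      ≡⟨ cong (λ b → S + toQ (suc (suc m)) * b) last-entry ⟩
    S + toQ (suc (suc m)) * (- (+ 1 / suc (suc m)) * S)
      ≡⟨ cancel S (toQ (suc (suc m))) (+ 1 / suc (suc m)) ⟩
    S - (+ 1 / suc (suc m) * toQ (suc (suc m))) * S
      ≡⟨ cong (λ c → S - c * S) (1/n*n≡1 (suc (suc m))) ⟩
    S - 1ℚ * S
      ≡⟨ trivial S ⟩
    0ℚ ∎
    where
    open ≡-Reasoning
    S : ℚ
    S = sumTo m (λ j → toQ (suc (suc m) C j) * bernoulli j)
    cancel : ∀ s n i → s + n * (- i * s) ≡ s - (i * n) * s
    cancel = solve-∀ ℚ-ring
    trivial : ∀ s → s - 1ℚ * s ≡ 0ℚ
    trivial = solve-∀ ℚ-ring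
    [m+2]C[m+1]≡m+2 : suc (suc m) C suc m ≡ suc (suc m)
    [m+2]C[m+1]≡m+2 = trans (nCk≡nC[n∸k] (ℕₚ.n≤1+n (suc m)))
      (trans (cong (suc (suc m) C_) (ℕₚ.m+n∸n≡m 1 (suc m))) (nC1≡n (suc (suc m))))
    last-entry : bernoulli (suc m) ≡ - (+ 1 / suc (suc m)) * S
    last-entry = trans (subst (λ n → at (bernList m ++ x ∷ []) n ≡ x) (length-bernList m) (at-length (bernList m) x))
      (cong (λ s → - (+ 1 / suc (suc m)) * s) (sumTo-cong-≤ m (λ j j≤m → cong (toQ (suc (suc m) C j) *_) (at-bernList m j j≤m))))
      where
      x = - (+ 1 / suc (suc m)) * sumTo m (λ j → toQ (suc (suc m) C j) * at (bernList m) j)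

  bernoulliSer : Ser
  bernoulliSer k = bernoulli k * invFact k

  bernoulliSer-*-gSer : mulSer bernoulliSer gSer ≗ oneSer
  bernoulliSer-*-gSer zero    = refl
  bernoulliSer-*-gSer (suc m) = begin
    sumTo (suc m) (λ j → bernoulliSer j * invFact (suc (suc m ∸ j)))
      ≡⟨ sumTo-cong-≤ (suc m) binomial-term ⟩
    sumTo (suc m) (λ j → toQ (suc (suc m) C j) * bernoulli j * invFact (suc (suc m)))
      ≡⟨ sumTo-*ʳ (suc m) (invFact (suc (suc m))) (λ j → toQ (suc (suc m) C j) * bernoulli j) ⟩
    sumTo (suc m) (λ j → toQ (suc (suc m) C j) * bernoulli j) * invFact (suc (suc m))
      ≡⟨ cong (_* invFact (suc (suc m))) (bernoulli-recurrence m) ⟩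
    0ℚ * invFact (suc (suc m))
      ≡⟨ *-zeroˡ (invFact (suc (suc m))) ⟩
    0ℚ ∎
    where
    open ≡-Reasoning
    shuffle : ∀ b c f → b * (c * f) ≡ c * b * f
    shuffle = solve-∀ ℚ-ring
    binomial-term : ∀ j → j ≤ suc m →
                    bernoulliSer j * invFact (suc (suc m ∸ j)) ≡ toQ (suc (suc m) C j) * bernoulli j * invFact (suc (suc m))
    binomial-term j j≤1+m = begin
      bernoulli j * invFact j * invFact (suc (suc m ∸ j))
        ≡⟨ cong (λ n → bernoulli j * invFact j * invFact n) (ℕₚ.+-∸-assoc 1 j≤1+m) ⟨
      bernoulli j * invFact j * invFact (suc (suc m) ∸ j)
        ≡⟨ *-assoc (bernoulli j) (invFact j) (invFact (suc (suc m) ∸ j)) ⟩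
      bernoulli j * (invFact j * invFact (suc (suc m) ∸ j))
        ≡⟨ cong (bernoulli j *_) (invFact-binomial (ℕₚ.m≤n⇒m≤1+n j≤1+m)) ⟩
      bernoulli j * (toQ (suc (suc m) C j) * invFact (suc (suc m)))
        ≡⟨ shuffle (bernoulli j) (toQ (suc (suc m) C j)) (invFact (suc (suc m))) ⟩
      toQ (suc (suc m) C j) * bernoulli j * invFact (suc (suc m)) ∎

  invSer-gSer : invSer gSer ≗ bernoulliSer
  invSer-gSer = invSer-unique gSer refl bernoulliSer bernoulliSer-*-gSer

  gSer+θgSer≗expSer : addSer gSer (θ gSer) ≗ expSer
  gSer+θgSer≗expSer k = begin
    invFact (suc k) + toQ k * invFact (suc k)  ≡⟨ factor (invFact (suc k)) (toQ k) ⟩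
    invFact (suc k) * (1ℚ + toQ k)             ≡⟨ cong (invFact (suc k) *_) (toQ-+ 1 k) ⟨
    invFact (suc k) * toQ (suc k)              ≡⟨ invFact-suc k ⟩
    invFact k                                  ∎
    where
    open ≡-Reasoning
    factor : ∀ x y → x + y * x ≡ x * (1ℚ + y)
    factor = solve-∀ ℚ-ring

  θbernoulliSer-*-gSer : mulSer (θ bernoulliSer) gSer ≗ scaleSer (- 1ℚ) (mulSer bernoulliSer (θ gSer))
  θbernoulliSer-*-gSer k = begin
    a                                          ≡⟨ rearrange a b ⟩
    (a + b) + - 1ℚ * b                         ≡⟨ cong (_+ - 1ℚ * b) (θ-mulSer bernoulliSer gSer k) ⟨
    toQ k * mulSer bernoulliSer gSer k + - 1ℚ * b  ≡⟨ cong (λ x → toQ k * x + - 1ℚ * b) (bernoulliSer-*-gSer k) ⟩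
    toQ k * oneSer k + - 1ℚ * b                ≡⟨ cong (_+ - 1ℚ * b) (θ-oneSer k) ⟩
    0ℚ + - 1ℚ * b                              ≡⟨ +-identityˡ (- 1ℚ * b) ⟩
    - 1ℚ * b                                   ∎
    where
    open ≡-Reasoning
    a = mulSer (θ bernoulliSer) gSer k
    b = mulSer bernoulliSer (θ gSer) k
    rearrange : ∀ a b → a ≡ (a + b) + - 1ℚ * b
    rearrange = solve-∀ ℚ-ring
    θ-oneSer : ∀ k → toQ k * oneSer k ≡ 0ℚ
    θ-oneSer zero    = refl
    θ-oneSer (suc k) = *-zeroʳ (toQ (suc k))

  [bernoulliSer-θbernoulliSer]-*-gSer :
    mulSer (addSer bernoulliSer (scaleSer (- 1ℚ) (θ bernoulliSer))) gSer ≗ addSer oneSer (mulSer bernoulliSer (θ gSer))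
  [bernoulliSer-θbernoulliSer]-*-gSer k = begin
    mulSer (addSer β (scaleSer (- 1ℚ) (θ β))) g k      ≡⟨ mulSer-distribʳ g β (scaleSer (- 1ℚ) (θ β)) k ⟩
    mulSer β g k + mulSer (scaleSer (- 1ℚ) (θ β)) g k  ≡⟨ cong₂ _+_ (bernoulliSer-*-gSer k) (mulSer-scaleˡ (- 1ℚ) (θ β) g k) ⟩
    oneSer k + - 1ℚ * mulSer (θ β) g k                 ≡⟨ cong (λ x → oneSer k + - 1ℚ * x) (θbernoulliSer-*-gSer k) ⟩
    oneSer k + - 1ℚ * (- 1ℚ * mulSer β (θ g) k)        ≡⟨ cong (λ x → oneSer k + x) (double-negation (mulSer β (θ g) k)) ⟩
    oneSer k + mulSer β (θ g) k                        ∎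
    where
    open ≡-Reasoning
    β = bernoulliSer
    g = gSer
    double-negation : ∀ x → - 1ℚ * (- 1ℚ * x) ≡ x
    double-negation = solve-∀ ℚ-ring

  [bernoulliSer-θbernoulliSer]-*-gSer² :
    mulSer (mulSer (addSer bernoulliSer (scaleSer (- 1ℚ) (θ bernoulliSer))) gSer) gSer ≗ expSer
  [bernoulliSer-θbernoulliSer]-*-gSer² = begin
    mulSer (mulSer R g) g                                 ≈⟨ mulSer-congʳ g [bernoulliSer-θbernoulliSer]-*-gSer ⟩
    mulSer (addSer oneSer (mulSer β (θ g))) g             ≈⟨ mulSer-distribʳ g oneSer (mulSer β (θ g)) ⟩
    addSer (mulSer oneSer g) (mulSer (mulSer β (θ g)) g)  ≈⟨ (λ k → cong₂ _+_ (mulSer-identityˡ g k) (β*θg*g≗θg k)) ⟩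
    addSer g (θ g)                                        ≈⟨ gSer+θgSer≗expSer ⟩
    expSer                                                ∎
    where
    open ≗-Reasoning
    β = bernoulliSer
    g = gSer
    R = addSer β (scaleSer (- 1ℚ) (θ β))

    β*θg*g≗θg : mulSer (mulSer β (θ g)) g ≗ θ g
    β*θg*g≗θg = begin
      mulSer (mulSer β (θ g)) g   ≈⟨ mulSer-congʳ g (mulSer-comm β (θ g)) ⟩
      mulSer (mulSer (θ g) β) g   ≈⟨ mulSer-assoc (θ g) β g ⟩
      mulSer (θ g) (mulSer β g)   ≈⟨ mulSer-congˡ (θ g) bernoulliSer-*-gSer ⟩
      mulSer (θ g) oneSer         ≈⟨ mulSer-identityʳ (θ g) ⟩
      θ g                         ∎

  expSer-*-bernoulliSer² : mulSer expSer (mulSer bernoulliSer bernoulliSer) ≗ addSer bernoulliSer (scaleSer (- 1ℚ) (θ bernoulliSer))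
  expSer-*-bernoulliSer² = begin
    mulSer expSer (mulSer β β)                  ≈⟨ mulSer-congʳ (mulSer β β) [bernoulliSer-θbernoulliSer]-*-gSer² ⟨
    mulSer (mulSer (mulSer R g) g) (mulSer β β) ≈⟨ mulSer-assoc (mulSer R g) g (mulSer β β) ⟩
    mulSer (mulSer R g) (mulSer g (mulSer β β)) ≈⟨ mulSer-assoc R g (mulSer g (mulSer β β)) ⟩
    mulSer R (mulSer g (mulSer g (mulSer β β))) ≈⟨ mulSer-congˡ R g*g*β*β≗1 ⟩
    mulSer R oneSer                             ≈⟨ mulSer-identityʳ R ⟩
    R                                           ∎
    where
    open ≗-Reasoning
    β = bernoulliSer
    g = gSer
    R = addSer β (scaleSer (- 1ℚ) (θ β))
    g*β≗1 : mulSer g β ≗ oneSer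
    g*β≗1 k = trans (mulSer-comm g β k) (bernoulliSer-*-gSer k)
    g*g*β*β≗1 : mulSer g (mulSer g (mulSer β β)) ≗ oneSer
    g*g*β*β≗1 = begin
      mulSer g (mulSer g (mulSer β β))  ≈⟨ mulSer-congˡ g (mulSer-assoc g β β) ⟨
      mulSer g (mulSer (mulSer g β) β)  ≈⟨ mulSer-congˡ g (mulSer-congʳ β g*β≗1) ⟩
      mulSer g (mulSer oneSer β)        ≈⟨ mulSer-congˡ g (mulSer-identityˡ β) ⟩
      mulSer g β                        ≈⟨ g*β≗1 ⟩
      oneSer                            ∎

module StirlingSeries where

  open RationalNumerals
  open FiniteSums
  open PowerSeries
  open import Data.Nat.Combinatorics using (nCk+nC[k+1]≡[n+1]C[k+1])
  open import Data.Nat.Combinatorics.Specification using (k>n⇒nCk≡0)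
  open import Data.Rational using (_+_; _*_; -_; _-_)
  open import Data.Rational.Properties

  expSer^ : ℕ → Ser
  expSer^ a k = toQ (a ^ k) * invFact k

  expSer≗expSer^1 : expSer ≗ expSer^ 1
  expSer≗expSer^1 k = trans (sym (*-identityˡ (invFact k))) (cong (λ n → toQ n * invFact k) (sym (ℕₚ.^-zeroˡ k)))

  θ-expSer^ : ∀ a → θ (expSer^ a) ≗ scaleSer (toQ a) (shiftSer (expSer^ a))
  θ-expSer^ a zero    = trans (*-zeroˡ (expSer^ a 0)) (sym (*-zeroʳ (toQ a)))
  θ-expSer^ a (suc k) = begin
    toQ (suc k) * (toQ (a ℕ.* a ^ k) * invFact (suc k))
      ≡⟨ cong (λ x → toQ (suc k) * (x * invFact (suc k))) (toQ-* a (a ^ k)) ⟩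
    toQ (suc k) * (toQ a * toQ (a ^ k) * invFact (suc k))
      ≡⟨ shuffle (toQ (suc k)) (toQ a) (toQ (a ^ k)) (invFact (suc k)) ⟩
    toQ a * (toQ (a ^ k) * (invFact (suc k) * toQ (suc k)))
      ≡⟨ cong (λ x → toQ a * (toQ (a ^ k) * x)) (invFact-suc k) ⟩
    toQ a * (toQ (a ^ k) * invFact k) ∎
    where
    open ≡-Reasoning
    shuffle : ∀ n a p i → n * (a * p * i) ≡ a * (p * (i * n))
    shuffle = solve-∀ ℚ-ring

  expSer^-unique : ∀ a F → F 0 ≡ 1ℚ → θ F ≗ scaleSer (toQ a) (shiftSer F) → F ≗ expSer^ a
  expSer^-unique a F F₀≡1 θF≗aF zero    = F₀≡1
  expSer^-unique a F F₀≡1 θF≗aF (suc k) = *-cancelʳ-toQ (suc k) (begin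
    F (suc k) * toQ (suc k)            ≡⟨ *-comm (F (suc k)) (toQ (suc k)) ⟩
    toQ (suc k) * F (suc k)            ≡⟨ θF≗aF (suc k) ⟩
    toQ a * F k                        ≡⟨ cong (toQ a *_) (expSer^-unique a F F₀≡1 θF≗aF k) ⟩
    toQ a * expSer^ a k                ≡⟨ θ-expSer^ a (suc k) ⟨
    toQ (suc k) * expSer^ a (suc k)    ≡⟨ *-comm (toQ (suc k)) (expSer^ a (suc k)) ⟩
    expSer^ a (suc k) * toQ (suc k)    ∎)
    where open ≡-Reasoning

  expSer^1-*-expSer^ : ∀ a → mulSer (expSer^ 1) (expSer^ a) ≗ expSer^ (suc a)
  expSer^1-*-expSer^ a = expSer^-unique (suc a) F refl θF≗[1+a]F
    where
    F = mulSer (expSer^ 1) (expSer^ a)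
    θF≗[1+a]F : θ F ≗ scaleSer (toQ (suc a)) (shiftSer F)
    θF≗[1+a]F k = begin
      θ F k
        ≡⟨ θ-mulSer (expSer^ 1) (expSer^ a) k ⟩
      mulSer (θ (expSer^ 1)) (expSer^ a) k + mulSer (expSer^ 1) (θ (expSer^ a)) k
        ≡⟨ cong₂ _+_ (mulSer-congʳ (expSer^ a) (θ-expSer^ 1) k) (mulSer-congˡ (expSer^ 1) (θ-expSer^ a) k) ⟩
      mulSer (scaleSer (toQ 1) (shiftSer (expSer^ 1))) (expSer^ a) k + mulSer (expSer^ 1) (scaleSer (toQ a) (shiftSer (expSer^ a))) k
        ≡⟨ cong₂ _+_ (trans (mulSer-scaleˡ (toQ 1) (shiftSer (expSer^ 1)) (expSer^ a) k)
                            (cong (toQ 1 *_) (mulSer-shiftˡ (expSer^ 1) (expSer^ a) k)))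
                     (trans (mulSer-scaleʳ (toQ a) (expSer^ 1) (shiftSer (expSer^ a)) k)
                            (cong (toQ a *_) (mulSer-shiftʳ (expSer^ a) (expSer^ 1) k))) ⟩
      toQ 1 * shiftSer F k + toQ a * shiftSer F k
        ≡⟨ *-distribʳ-+ (shiftSer F k) (toQ 1) (toQ a) ⟨
      (toQ 1 + toQ a) * shiftSer F k
        ≡⟨ cong (_* shiftSer F k) (toQ-+ 1 a) ⟨
      toQ (suc a) * shiftSer F k ∎
      where open ≡-Reasoning

  shiftSer-gSer : shiftSer gSer ≗ addSer (expSer^ 1) (scaleSer (- 1ℚ) oneSer)
  shiftSer-gSer zero    = refl
  shiftSer-gSer (suc k) = trans (expSer≗expSer^1 (suc k))
    (sym (trans (cong (expSer^ 1 (suc k) +_) (*-zeroʳ (- 1ℚ))) (+-identityʳ (expSer^ 1 (suc k)))))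

  altSign : ℕ → ℚ
  altSign m = powQ (- 1ℚ) m

  altSign-+2 : ∀ m → altSign (suc (suc m)) ≡ altSign m
  altSign-+2 m = double-negation (altSign m)
    where
    double-negation : ∀ x → - 1ℚ * (- 1ℚ * x) ≡ x
    double-negation = solve-∀ ℚ-ring

  -- e^z (e^z - 1)^n, expanded by the binomial theorem
  binomialExpSer : ℕ → Ser
  binomialExpSer n k = sumTo n (λ j → toQ (n C j) * altSign (n ℕ.+ j) * expSer^ (suc j) k)

  pascal-term : ∀ n j (e : ℚ) →
    toQ (n C j) * altSign (n ℕ.+ j) * e + toQ (n C suc j) * altSign (n ℕ.+ j) * e ≡ toQ (suc n C suc j) * altSign (suc n ℕ.+ suc j) * e
  pascal-term n j e = begin
    toQ (n C j) * altSign (n ℕ.+ j) * e + toQ (n C suc j) * altSign (n ℕ.+ j) * e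
      ≡⟨ factor (toQ (n C j)) (toQ (n C suc j)) (altSign (n ℕ.+ j)) e ⟩
    (toQ (n C j) + toQ (n C suc j)) * altSign (n ℕ.+ j) * e
      ≡⟨ cong (λ x → x * altSign (n ℕ.+ j) * e) (trans (sym (toQ-+ (n C j) (n C suc j))) (cong toQ (nCk+nC[k+1]≡[n+1]C[k+1] n j))) ⟩
    toQ (suc n C suc j) * altSign (n ℕ.+ j) * e
      ≡⟨ cong (λ x → toQ (suc n C suc j) * x * e) (trans (sym (altSign-+2 (n ℕ.+ j))) (cong (λ m → altSign (suc m)) (sym (ℕₚ.+-suc n j)))) ⟩
    toQ (suc n C suc j) * altSign (suc n ℕ.+ suc j) * e ∎
    where
    open ≡-Reasoning
    factor : ∀ a b c d → a * c * d + b * c * d ≡ (a + b) * c * d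
    factor = solve-∀ ℚ-ring

  neg-binomialExpSer : ∀ n k →
    - 1ℚ * binomialExpSer n k ≡ toQ (n C 0) * altSign (suc (n ℕ.+ 0)) * expSer^ 1 k
                                + sumTo n (λ j → toQ (n C suc j) * altSign (n ℕ.+ j) * expSer^ (suc (suc j)) k)
  neg-binomialExpSer n k = begin
    - 1ℚ * binomialExpSer n k
      ≡⟨ sumTo-*ˡ n (- 1ℚ) _ ⟨
    sumTo n (λ j → - 1ℚ * (toQ (n C j) * altSign (n ℕ.+ j) * e j))
      ≡⟨ sumTo-cong n (λ j → absorb (toQ (n C j)) (altSign (n ℕ.+ j)) (e j)) ⟩
    sumTo n (λ j → toQ (n C j) * altSign (suc (n ℕ.+ j)) * e j)
      ≡⟨ sumTo-extend n (suc n) _ (ℕₚ.n≤1+n n) beyond-n ⟨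
    sumTo (suc n) (λ j → toQ (n C j) * altSign (suc (n ℕ.+ j)) * e j)
      ≡⟨ sumTo-sucˡ n _ ⟩
    toQ (n C 0) * altSign (suc (n ℕ.+ 0)) * e 0 + sumTo n (λ j → toQ (n C suc j) * altSign (suc (n ℕ.+ suc j)) * e (suc j))
      ≡⟨ cong (toQ (n C 0) * altSign (suc (n ℕ.+ 0)) * e 0 +_) (sumTo-cong n (λ j → cong (λ x → toQ (n C suc j) * x * e (suc j)) (sign j))) ⟩
    toQ (n C 0) * altSign (suc (n ℕ.+ 0)) * e 0 + sumTo n (λ j → toQ (n C suc j) * altSign (n ℕ.+ j) * e (suc j)) ∎
    where
    open ≡-Reasoning
    e : ℕ → ℚ
    e j = expSer^ (suc j) k
    absorb : ∀ c s x → - 1ℚ * (c * s * x) ≡ c * (- 1ℚ * s) * x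
    absorb = solve-∀ ℚ-ring
    sign : ∀ j → altSign (suc (n ℕ.+ suc j)) ≡ altSign (n ℕ.+ j)
    sign j = trans (cong (λ m → altSign (suc m)) (ℕₚ.+-suc n j)) (altSign-+2 (n ℕ.+ j))
    beyond-n : ∀ i → n < i → toQ (n C i) * altSign (suc (n ℕ.+ i)) * e i ≡ 0ℚ
    beyond-n i n<i rewrite k>n⇒nCk≡0 n<i = trans (cong (_* e i) (*-zeroˡ (altSign (suc (n ℕ.+ i))))) (*-zeroˡ (e i))

  binomialExpSer-suc : ∀ n → binomialExpSer (suc n) ≗ addSer (mulSer (expSer^ 1) (binomialExpSer n)) (scaleSer (- 1ℚ) (binomialExpSer n))
  binomialExpSer-suc n k = begin
    T (suc n) k
      ≡⟨ sumTo-sucˡ n (λ j → toQ (suc n C j) * altSign (suc n ℕ.+ j) * e j) ⟩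
    X₀ + sumTo n (λ j → toQ (suc n C suc j) * altSign (suc n ℕ.+ suc j) * e (suc j))
      ≡⟨ cong (X₀ +_) (trans (sumTo-cong n (λ j → sym (pascal-term n j (e (suc j))))) (sumTo-+ n _ _)) ⟩
    X₀ + (S₁ + S₂)
      ≡⟨ rotate S₁ X₀ S₂ ⟩
    S₁ + (X₀ + S₂)
      ≡⟨ cong₂ _+_ (sym e*T≡S₁) (sym (neg-binomialExpSer n k)) ⟩
    mulSer (expSer^ 1) (T n) k + - 1ℚ * T n k ∎
    where
    open ≡-Reasoning
    T = binomialExpSer
    e : ℕ → ℚ
    e j = expSer^ (suc j) k
    X₀ = toQ (n C 0) * altSign (suc (n ℕ.+ 0)) * e 0
    S₁ = sumTo n (λ j → toQ (n C j) * altSign (n ℕ.+ j) * e (suc j))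
    S₂ = sumTo n (λ j → toQ (n C suc j) * altSign (n ℕ.+ j) * e (suc j))
    rotate : ∀ a b c → b + (a + c) ≡ a + (b + c)
    rotate = solve-∀ ℚ-ring
    e*T≡S₁ : mulSer (expSer^ 1) (T n) k ≡ S₁
    e*T≡S₁ = trans (mulSer-sumˡ n (expSer^ 1) (λ j → scaleSer (toQ (n C j) * altSign (n ℕ.+ j)) (expSer^ (suc j))) k)
      (sumTo-cong n (λ j → trans (mulSer-scaleʳ (toQ (n C j) * altSign (n ℕ.+ j)) (expSer^ 1) (expSer^ (suc j)) k)
                                 (cong (toQ (n C j) * altSign (n ℕ.+ j) *_) (expSer^1-*-expSer^ (suc j) k))))

  expSer-*-[shiftSer-gSer]^ : ∀ n → mulSer expSer (powSer (shiftSer gSer) n) ≗ binomialExpSer n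
  expSer-*-[shiftSer-gSer]^ zero k = begin
    mulSer expSer oneSer k                           ≡⟨ mulSer-identityʳ expSer k ⟩
    expSer k                                         ≡⟨ expSer≗expSer^1 k ⟩
    expSer^ 1 k                                      ≡⟨ units (expSer^ 1 k) ⟨
    toQ (0 C 0) * altSign 0 * expSer^ 1 k            ∎
    where
    open ≡-Reasoning
    units : ∀ x → 1ℚ * 1ℚ * x ≡ x
    units = solve-∀ ℚ-ring
  expSer-*-[shiftSer-gSer]^ (suc n) = begin
    mulSer expSer (mulSer zg (powSer zg n))                   ≈⟨ mulSer-assoc expSer zg (powSer zg n) ⟨
    mulSer (mulSer expSer zg) (powSer zg n)                   ≈⟨ mulSer-congʳ (powSer zg n) (mulSer-comm expSer zg) ⟩
    mulSer (mulSer zg expSer) (powSer zg n)                   ≈⟨ mulSer-assoc zg expSer (powSer zg n) ⟩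
    mulSer zg (mulSer expSer (powSer zg n))                   ≈⟨ mulSer-cong shiftSer-gSer (expSer-*-[shiftSer-gSer]^ n) ⟩
    mulSer (addSer (expSer^ 1) (scaleSer (- 1ℚ) oneSer)) (T n) ≈⟨ mulSer-distribʳ (T n) (expSer^ 1) (scaleSer (- 1ℚ) oneSer) ⟩
    addSer (mulSer (expSer^ 1) (T n)) (mulSer (scaleSer (- 1ℚ) oneSer) (T n))
      ≈⟨ (λ k → cong (mulSer (expSer^ 1) (T n) k +_) (trans (mulSer-scaleˡ (- 1ℚ) oneSer (T n) k) (cong (- 1ℚ *_) (mulSer-identityˡ (T n) k)))) ⟩
    addSer (mulSer (expSer^ 1) (T n)) (scaleSer (- 1ℚ) (T n)) ≈⟨ binomialExpSer-suc n ⟨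
    T (suc n)                                                 ∎
    where
    open ≗-Reasoning
    zg = shiftSer gSer
    T = binomialExpSer

  shiftSerⁿ : ℕ → Ser → Ser
  shiftSerⁿ zero    f = f
  shiftSerⁿ (suc n) f = shiftSer (shiftSerⁿ n f)

  shiftSer-cong : ∀ {f g} → f ≗ g → shiftSer f ≗ shiftSer g
  shiftSer-cong f≗g zero    = refl
  shiftSer-cong f≗g (suc k) = f≗g k

  mulSer-shiftSerⁿʳ : ∀ n f h → mulSer h (shiftSerⁿ n f) ≗ shiftSerⁿ n (mulSer h f)
  mulSer-shiftSerⁿʳ zero    f h = ≗.refl
  mulSer-shiftSerⁿʳ (suc n) f h k = trans (mulSer-shiftʳ (shiftSerⁿ n f) h k) (shiftSer-cong (mulSer-shiftSerⁿʳ n f h) k)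

  powSer-shiftSer : ∀ f n → powSer (shiftSer f) n ≗ shiftSerⁿ n (powSer f n)
  powSer-shiftSer f zero    = ≗.refl
  powSer-shiftSer f (suc n) = begin
    mulSer (shiftSer f) (powSer (shiftSer f) n)      ≈⟨ mulSer-congˡ (shiftSer f) (powSer-shiftSer f n) ⟩
    mulSer (shiftSer f) (shiftSerⁿ n (powSer f n))   ≈⟨ mulSer-shiftˡ f (shiftSerⁿ n (powSer f n)) ⟩
    shiftSer (mulSer f (shiftSerⁿ n (powSer f n)))   ≈⟨ shiftSer-cong (mulSer-shiftSerⁿʳ n (powSer f n) f) ⟩
    shiftSerⁿ (suc n) (powSer f (suc n))             ∎
    where open ≗-Reasoning

  shiftSerⁿ-≥ : ∀ n f s → n ≤ s → shiftSerⁿ n f s ≡ f (s ∸ n)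
  shiftSerⁿ-≥ zero    f s       _         = refl
  shiftSerⁿ-≥ (suc n) f (suc s) (s≤s n≤s) = shiftSerⁿ-≥ n f s n≤s

  shiftSerⁿ-< : ∀ n f s → s < n → shiftSerⁿ n f s ≡ 0ℚ
  shiftSerⁿ-< (suc n) f zero    _         = refl
  shiftSerⁿ-< (suc n) f (suc s) (s≤s s<n) = shiftSerⁿ-< n f s s<n

  alternatingPowerSum : ℕ → ℕ → ℚ
  alternatingPowerSum n s = sumTo n (λ j → toQ (n C j) * altSign (n ℕ.+ j) * toQ (suc j ^ s))

  s!*binomialExpSer : ∀ n s → toQ (s !) * binomialExpSer n s ≡ alternatingPowerSum n s
  s!*binomialExpSer n s = trans (sym (sumTo-*ˡ n (toQ (s !)) _)) (sumTo-cong n (λ j → begin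
    toQ (s !) * (c j * (toQ (suc j ^ s) * invFact s))  ≡⟨ shuffle (toQ (s !)) (c j) (toQ (suc j ^ s)) (invFact s) ⟩
    c j * toQ (suc j ^ s) * (invFact s * toQ (s !))    ≡⟨ cong (c j * toQ (suc j ^ s) *_) (invFact*n!≡1 s) ⟩
    c j * toQ (suc j ^ s) * 1ℚ                         ≡⟨ *-identityʳ (c j * toQ (suc j ^ s)) ⟩
    c j * toQ (suc j ^ s)                              ∎))
    where
    open ≡-Reasoning
    c : ℕ → ℚ
    c j = toQ (n C j) * altSign (n ℕ.+ j)
    shuffle : ∀ f c p i → f * (c * (p * i)) ≡ c * p * (i * f)
    shuffle = solve-∀ ℚ-ring

  n!*stirling : ∀ s n → toQ (n !) * stirling (suc s) n ≡ alternatingPowerSum n s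
  n!*stirling s n = begin
    toQ (n !) * (invFact n * A)   ≡⟨ *-assoc (toQ (n !)) (invFact n) A ⟨
    toQ (n !) * invFact n * A     ≡⟨ cong (_* A) (trans (*-comm (toQ (n !)) (invFact n)) (invFact*n!≡1 n)) ⟩
    1ℚ * A                        ≡⟨ *-identityˡ A ⟩
    A                             ∎
    where
    open ≡-Reasoning
    A = alternatingPowerSum n s

  n!*stirling≡s!*[zⁿeᶻgⁿ] : ∀ s n → toQ (n !) * stirling (suc s) n ≡ toQ (s !) * shiftSerⁿ n (mulSer expSer (powSer gSer n)) s
  n!*stirling≡s!*[zⁿeᶻgⁿ] s n = begin
    toQ (n !) * stirling (suc s) n                            ≡⟨ n!*stirling s n ⟩
    alternatingPowerSum n s                                   ≡⟨ s!*binomialExpSer n s ⟨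
    toQ (s !) * binomialExpSer n s                            ≡⟨ cong (toQ (s !) *_) (expSer-*-[shiftSer-gSer]^ n s) ⟨
    toQ (s !) * mulSer expSer (powSer (shiftSer gSer) n) s    ≡⟨ cong (toQ (s !) *_) e*[zg]ⁿ≡zⁿ*e*gⁿ ⟩
    toQ (s !) * shiftSerⁿ n (mulSer expSer (powSer gSer n)) s ∎
    where
    open ≡-Reasoning
    e*[zg]ⁿ≡zⁿ*e*gⁿ : mulSer expSer (powSer (shiftSer gSer) n) s ≡ shiftSerⁿ n (mulSer expSer (powSer gSer n)) s
    e*[zg]ⁿ≡zⁿ*e*gⁿ = trans (mulSer-congˡ expSer (powSer-shiftSer gSer n) s) (mulSer-shiftSerⁿʳ n (powSer gSer n) expSer s)

  stirling-from-series : ∀ s n → n ≤ s → toQ (n !) * stirling (suc s) n ≡ toQ (s !) * mulSer expSer (powSer gSer n) (s ∸ n)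
  stirling-from-series s n n≤s =
    trans (n!*stirling≡s!*[zⁿeᶻgⁿ] s n) (cong (toQ (s !) *_) (shiftSerⁿ-≥ n (mulSer expSer (powSer gSer n)) s n≤s))

  stirling-vanishes : ∀ s n → s < n → toQ (n !) * stirling (suc s) n ≡ 0ℚ
  stirling-vanishes s n s<n = trans (n!*stirling≡s!*[zⁿeᶻgⁿ] s n)
    (trans (cong (toQ (s !) *_) (shiftSerⁿ-< n (mulSer expSer (powSer gSer n)) s s<n)) (*-zeroʳ (toQ (s !))))

module StateCoefficients where

  open RationalNumerals
  open FiniteSums
  open import Data.Nat using (_≡ᵇ_)
  open import Data.Nat.Properties using (≡ᵇ⇒≡; 0≢1+n)
  open import Data.Rational using (_+_; _*_; -_)
  open import Data.Rational.Properties
  open import Data.Bool using (true; false; T; _∧_; not; if_then_else_)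
  open import Data.Bool.Properties using (∧-commutativeMonoid; ∧-zeroʳ; T-∧; T-≡)
  open import Algebra.Bundles using (CommutativeMonoid)
  import Algebra.Properties.CommutativeSemigroup as CommutativeSemigroupProperties
  open import Data.List using ([]; _∷_; _++_)
  open import Data.List.Properties using (map-++)
  open import Data.Product using (_,_; proj₁; proj₂)
  open import Function.Bundles using (Equivalence)
  open import Relation.Nullary using (contradiction)

  open CommutativeSemigroupProperties (CommutativeMonoid.commutativeSemigroup ∧-commutativeMonoid)
    using () renaming (x∙yz≈y∙xz to ∧-swap)

  0≡ᵇ-sym : ∀ b → (0 ≡ᵇ b) ≡ (b ≡ᵇ 0)
  0≡ᵇ-sym zero    = refl
  0≡ᵇ-sym (suc b) = refl

  monoEq-incAt : ∀ i e μ → monoEq (incAt i e) μ ≡ not (expAt i μ ≡ᵇ 0) ∧ monoEq e (decAt i μ)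
  monoEq-incAt zero    []       []                 = refl
  monoEq-incAt zero    []       (zero ∷ bs)        = refl
  monoEq-incAt zero    []       (suc zero ∷ bs)    = refl
  monoEq-incAt zero    []       (suc (suc b) ∷ bs) = refl
  monoEq-incAt zero    (a ∷ as) []                 = refl
  monoEq-incAt zero    (a ∷ as) (zero ∷ bs)        = refl
  monoEq-incAt zero    (a ∷ as) (suc b ∷ bs)       = refl
  monoEq-incAt (suc i) []       []                 = monoEq-incAt i [] []
  monoEq-incAt (suc i) []       (b ∷ bs)
    rewrite monoEq-incAt i [] bs | 0≡ᵇ-sym b       = ∧-swap (b ≡ᵇ 0) (not (expAt i bs ≡ᵇ 0)) (monoEq [] (decAt i bs))
  monoEq-incAt (suc i) (a ∷ as) []
    rewrite monoEq-incAt i as []                   = ∧-zeroʳ (a ≡ᵇ 0)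
  monoEq-incAt (suc i) (a ∷ as) (b ∷ bs)
    rewrite monoEq-incAt i as bs                   = ∧-swap (a ≡ᵇ b) (not (expAt i bs ≡ᵇ 0)) (monoEq as (decAt i bs))

  monoEq-decAt : ∀ i e μ p → expAt i e ≡ suc p → monoEq (decAt i e) μ ≡ monoEq e (incAt i μ)
  monoEq-decAt zero    (.(suc p) ∷ as) []       p refl = refl
  monoEq-decAt zero    (.(suc p) ∷ as) (b ∷ bs) p refl = refl
  monoEq-decAt (suc i) (a ∷ as)        []       p eq   = cong ((a ≡ᵇ 0) ∧_) (monoEq-decAt i as [] p eq)
  monoEq-decAt (suc i) (a ∷ as)        (b ∷ bs) p eq   = cong ((a ≡ᵇ b) ∧_) (monoEq-decAt i as bs p eq)

  monoEq⇒expAt≡ : ∀ i e μ → T (monoEq e μ) → expAt i e ≡ expAt i μ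
  monoEq⇒expAt≡ i       []       []       _  = refl
  monoEq⇒expAt≡ zero    []       (b ∷ bs) eq = sym (≡ᵇ⇒≡ b 0 (proj₁ (Equivalence.to T-∧ eq)))
  monoEq⇒expAt≡ (suc i) []       (b ∷ bs) eq = monoEq⇒expAt≡ i [] bs (proj₂ (Equivalence.to T-∧ eq))
  monoEq⇒expAt≡ zero    (a ∷ as) []       eq = ≡ᵇ⇒≡ a 0 (proj₁ (Equivalence.to T-∧ eq))
  monoEq⇒expAt≡ (suc i) (a ∷ as) []       eq = monoEq⇒expAt≡ i as [] (proj₂ (Equivalence.to T-∧ eq))
  monoEq⇒expAt≡ zero    (a ∷ as) (b ∷ bs) eq = ≡ᵇ⇒≡ a b (proj₁ (Equivalence.to T-∧ eq))
  monoEq⇒expAt≡ (suc i) (a ∷ as) (b ∷ bs) eq = monoEq⇒expAt≡ i as bs (proj₂ (Equivalence.to T-∧ eq))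

  expAt-incAt : ∀ i μ → expAt i (incAt i μ) ≡ suc (expAt i μ)
  expAt-incAt zero    []       = refl
  expAt-incAt zero    (e ∷ es) = refl
  expAt-incAt (suc i) []       = expAt-incAt i []
  expAt-incAt (suc i) (e ∷ es) = expAt-incAt i es

  coeff-∷ : ∀ c e v μ → coeff ((c , e) ∷ v) μ ≡ (if monoEq e μ then c else 0ℚ) + coeff v μ
  coeff-∷ c e v μ with monoEq e μ
  ... | true  = refl
  ... | false = sym (+-identityˡ (coeff v μ))

  if-*ˡ : ∀ b q c → (if b then q * c else 0ℚ) ≡ q * (if b then c else 0ℚ)
  if-*ˡ true  q c = refl
  if-*ˡ false q c = sym (*-zeroʳ q)

  coeff-++ : ∀ v w μ → coeff (v ++ w) μ ≡ coeff v μ + coeff w μ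
  coeff-++ []            w μ = sym (+-identityˡ (coeff w μ))
  coeff-++ ((c , e) ∷ v) w μ = begin
    coeff ((c , e) ∷ v ++ w) μ          ≡⟨ coeff-∷ c e (v ++ w) μ ⟩
    x + coeff (v ++ w) μ                ≡⟨ cong (x +_) (coeff-++ v w μ) ⟩
    x + (coeff v μ + coeff w μ)         ≡⟨ +-assoc x (coeff v μ) (coeff w μ) ⟨
    (x + coeff v μ) + coeff w μ         ≡⟨ cong (_+ coeff w μ) (coeff-∷ c e v μ) ⟨
    coeff ((c , e) ∷ v) μ + coeff w μ   ∎
    where
    open ≡-Reasoning
    x = if monoEq e μ then c else 0ℚ

  coeff-scaleS : ∀ q v μ → coeff (scaleS q v) μ ≡ q * coeff v μ
  coeff-scaleS q []            μ = sym (*-zeroʳ q)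
  coeff-scaleS q ((c , e) ∷ v) μ = begin
    coeff ((q * c , e) ∷ scaleS q v) μ                      ≡⟨ coeff-∷ (q * c) e (scaleS q v) μ ⟩
    (if monoEq e μ then q * c else 0ℚ) + coeff (scaleS q v) μ ≡⟨ cong₂ _+_ (if-*ˡ (monoEq e μ) q c) (coeff-scaleS q v μ) ⟩
    q * x + q * coeff v μ                                   ≡⟨ *-distribˡ-+ q x (coeff v μ) ⟨
    q * (x + coeff v μ)                                     ≡⟨ cong (q *_) (coeff-∷ c e v μ) ⟨
    q * coeff ((c , e) ∷ v) μ                               ∎
    where
    open ≡-Reasoning
    x = if monoEq e μ then c else 0ℚ

  coeff-negS : ∀ v μ → coeff (negS v) μ ≡ - coeff v μ
  coeff-negS v μ = trans (coeff-scaleS (- 1ℚ) v μ) (trans (sym (neg-distribˡ-* 1ℚ (coeff v μ))) (cong -_ (*-identityˡ (coeff v μ))))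

  coeff-sumSt : ∀ N f μ → coeff (sumSt N f) μ ≡ sumTo N (λ i → coeff (f i) μ)
  coeff-sumSt zero    f μ = refl
  coeff-sumSt (suc N) f μ = trans (coeff-++ (sumSt N f) (f (suc N)) μ) (cong (_+ coeff (f (suc N)) μ) (coeff-sumSt N f μ))

  coeff-hmode-neg : ∀ i v μ → coeff (hmode -[1+ i ] v) μ ≡ (if not (expAt i μ ≡ᵇ 0) then coeff v (decAt i μ) else 0ℚ)
  coeff-hmode-neg i [] μ with expAt i μ ≡ᵇ 0
  ... | true  = refl
  ... | false = refl
  coeff-hmode-neg i ((c , e) ∷ v) μ = begin
    coeff ((c , incAt i e) ∷ hmode -[1+ i ] v) μ
      ≡⟨ coeff-∷ c (incAt i e) (hmode -[1+ i ] v) μ ⟩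
    (if monoEq (incAt i e) μ then c else 0ℚ) + coeff (hmode -[1+ i ] v) μ
      ≡⟨ cong₂ _+_ (cong (if_then c else 0ℚ) (monoEq-incAt i e μ)) (coeff-hmode-neg i v μ) ⟩
    (if nonzero ∧ monoEq e (decAt i μ) then c else 0ℚ) + (if nonzero then coeff v (decAt i μ) else 0ℚ)
      ≡⟨ merge nonzero ⟩
    (if nonzero then (if monoEq e (decAt i μ) then c else 0ℚ) + coeff v (decAt i μ) else 0ℚ)
      ≡⟨ cong (if nonzero then_else 0ℚ) (coeff-∷ c e v (decAt i μ)) ⟨
    (if nonzero then coeff ((c , e) ∷ v) (decAt i μ) else 0ℚ) ∎
    where
    open ≡-Reasoning
    nonzero = not (expAt i μ ≡ᵇ 0)
    merge : ∀ z → (if z ∧ monoEq e (decAt i μ) then c else 0ℚ) + (if z then coeff v (decAt i μ) else 0ℚ)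
                ≡ (if z then (if monoEq e (decAt i μ) then c else 0ℚ) + coeff v (decAt i μ) else 0ℚ)
    merge true  = refl
    merge false = +-identityˡ 0ℚ

  coeff-hmode-pos-single : ∀ i c e μ →
    (if monoEq (decAt i e) μ then toQ (suc i) * toQ (expAt i e) * c else 0ℚ)
    ≡ toQ (suc i) * toQ (suc (expAt i μ)) * (if monoEq e (incAt i μ) then c else 0ℚ)
  coeff-hmode-pos-single i c e μ with expAt i e in eᵢ≡
  ... | zero with monoEq e (incAt i μ) in e≈μ⁺
  ...   | true  = contradiction (trans (sym eᵢ≡) (trans (monoEq⇒expAt≡ i e (incAt i μ) (Equivalence.from T-≡ e≈μ⁺)) (expAt-incAt i μ))) 0≢1+n
  ...   | false = trans (no-contribution (monoEq (decAt i e) μ)) (sym (*-zeroʳ (toQ (suc i) * toQ (suc (expAt i μ)))))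
    where
    no-contribution : ∀ b → (if b then toQ (suc i) * toQ 0 * c else 0ℚ) ≡ 0ℚ
    no-contribution true  = trans (cong (_* c) (*-zeroʳ (toQ (suc i)))) (*-zeroˡ c)
    no-contribution false = refl
  coeff-hmode-pos-single i c e μ | suc p rewrite monoEq-decAt i e μ p eᵢ≡ with monoEq e (incAt i μ) in e≈μ⁺
  ... | true  = cong (λ n → toQ (suc i) * toQ n * c)
                     (trans (sym eᵢ≡) (trans (monoEq⇒expAt≡ i e (incAt i μ) (Equivalence.from T-≡ e≈μ⁺)) (expAt-incAt i μ)))
  ... | false = sym (*-zeroʳ (toQ (suc i) * toQ (suc (expAt i μ))))

  coeff-hmode-pos : ∀ i v μ → coeff (hmode (ℤ.+ suc i) v) μ ≡ toQ (suc i) * toQ (suc (expAt i μ)) * coeff v (incAt i μ)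
  coeff-hmode-pos i []            μ = sym (*-zeroʳ (toQ (suc i) * toQ (suc (expAt i μ))))
  coeff-hmode-pos i ((c , e) ∷ v) μ = begin
    coeff ((toQ (suc i) * toQ (expAt i e) * c , decAt i e) ∷ hmode (ℤ.+ suc i) v) μ
      ≡⟨ coeff-∷ (toQ (suc i) * toQ (expAt i e) * c) (decAt i e) (hmode (ℤ.+ suc i) v) μ ⟩
    (if monoEq (decAt i e) μ then toQ (suc i) * toQ (expAt i e) * c else 0ℚ) + coeff (hmode (ℤ.+ suc i) v) μ
      ≡⟨ cong₂ _+_ (coeff-hmode-pos-single i c e μ) (coeff-hmode-pos i v μ) ⟩
    K * (if monoEq e (incAt i μ) then c else 0ℚ) + K * coeff v (incAt i μ)
      ≡⟨ *-distribˡ-+ K _ (coeff v (incAt i μ)) ⟨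
    K * ((if monoEq e (incAt i μ) then c else 0ℚ) + coeff v (incAt i μ))
      ≡⟨ cong (K *_) (coeff-∷ c e v (incAt i μ)) ⟨
    K * coeff ((c , e) ∷ v) (incAt i μ) ∎
    where
    open ≡-Reasoning
    K = toQ (suc i) * toQ (suc (expAt i μ))

  hmode-cong : ∀ m {v w} → v ≈ w → hmode m v ≈ hmode m w
  hmode-cong (ℤ.+ zero)  v≈w μ = refl
  hmode-cong (ℤ.+ suc i) {v} {w} v≈w μ = begin
    coeff (hmode (ℤ.+ suc i) v) μ                              ≡⟨ coeff-hmode-pos i v μ ⟩
    toQ (suc i) * toQ (suc (expAt i μ)) * coeff v (incAt i μ)  ≡⟨ cong (toQ (suc i) * toQ (suc (expAt i μ)) *_) (v≈w (incAt i μ)) ⟩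
    toQ (suc i) * toQ (suc (expAt i μ)) * coeff w (incAt i μ)  ≡⟨ coeff-hmode-pos i w μ ⟨
    coeff (hmode (ℤ.+ suc i) w) μ                              ∎
    where open ≡-Reasoning
  hmode-cong -[1+ i ] {v} {w} v≈w μ = begin
    coeff (hmode -[1+ i ] v) μ                                          ≡⟨ coeff-hmode-neg i v μ ⟩
    (if not (expAt i μ ≡ᵇ 0) then coeff v (decAt i μ) else 0ℚ)          ≡⟨ cong (if not (expAt i μ ≡ᵇ 0) then_else 0ℚ) (v≈w (decAt i μ)) ⟩
    (if not (expAt i μ ≡ᵇ 0) then coeff w (decAt i μ) else 0ℚ)          ≡⟨ coeff-hmode-neg i w μ ⟨
    coeff (hmode -[1+ i ] w) μ                                          ∎
    where open ≡-Reasoning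

  hmode-++ : ∀ m v w → hmode m (v ++ w) ≡ hmode m v ++ hmode m w
  hmode-++ (ℤ.+ zero)  v w = refl
  hmode-++ (ℤ.+ suc i) v w = map-++ _ v w
  hmode-++ -[1+ i ]    v w = map-++ _ v w

  hmode-sumSt : ∀ m N f → hmode m (sumSt N f) ≡ sumSt N (λ i → hmode m (f i))
  hmode-sumSt m zero    f = refl
  hmode-sumSt m (suc N) f = trans (hmode-++ m (sumSt N f) (f (suc N))) (cong (_++ hmode m (f (suc N))) (hmode-sumSt m N f))

  coeff-hmode-scaleS : ∀ m q v μ → coeff (hmode m (scaleS q v)) μ ≡ q * coeff (hmode m v) μ
  coeff-hmode-scaleS (ℤ.+ zero)  q v μ = sym (*-zeroʳ q)
  coeff-hmode-scaleS (ℤ.+ suc i) q v μ = begin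
    coeff (hmode (ℤ.+ suc i) (scaleS q v)) μ  ≡⟨ coeff-hmode-pos i (scaleS q v) μ ⟩
    K * coeff (scaleS q v) (incAt i μ)         ≡⟨ cong (K *_) (coeff-scaleS q v (incAt i μ)) ⟩
    K * (q * coeff v (incAt i μ))              ≡⟨ swap K q (coeff v (incAt i μ)) ⟩
    q * (K * coeff v (incAt i μ))              ≡⟨ cong (q *_) (coeff-hmode-pos i v μ) ⟨
    q * coeff (hmode (ℤ.+ suc i) v) μ          ∎
    where
    open ≡-Reasoning
    K = toQ (suc i) * toQ (suc (expAt i μ))
    swap : ∀ a b c → a * (b * c) ≡ b * (a * c)
    swap = solve-∀ ℚ-ring
  coeff-hmode-scaleS -[1+ i ] q v μ = begin
    coeff (hmode -[1+ i ] (scaleS q v)) μ                                  ≡⟨ coeff-hmode-neg i (scaleS q v) μ ⟩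
    (if nonzero then coeff (scaleS q v) (decAt i μ) else 0ℚ)               ≡⟨ cong (if nonzero then_else 0ℚ) (coeff-scaleS q v (decAt i μ)) ⟩
    (if nonzero then q * coeff v (decAt i μ) else 0ℚ)                      ≡⟨ if-*ˡ nonzero q (coeff v (decAt i μ)) ⟩
    q * (if nonzero then coeff v (decAt i μ) else 0ℚ)                      ≡⟨ cong (q *_) (coeff-hmode-neg i v μ) ⟨
    q * coeff (hmode -[1+ i ] v) μ                                         ∎
    where
    open ≡-Reasoning
    nonzero = not (expAt i μ ≡ᵇ 0)

  coeff-hmode-lincomb : ∀ m N (c : ℕ → ℚ) (S : ℕ → State) μ →
    coeff (hmode m (sumSt N (λ k → scaleS (c k) (S k)))) μ ≡ sumTo N (λ k → c k * coeff (hmode m (S k)) μ)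
  coeff-hmode-lincomb m N c S μ = begin
    coeff (hmode m (sumSt N (λ k → scaleS (c k) (S k)))) μ   ≡⟨ cong (λ v → coeff v μ) (hmode-sumSt m N (λ k → scaleS (c k) (S k))) ⟩
    coeff (sumSt N (λ k → hmode m (scaleS (c k) (S k)))) μ   ≡⟨ coeff-sumSt N (λ k → hmode m (scaleS (c k) (S k))) μ ⟩
    sumTo N (λ k → coeff (hmode m (scaleS (c k) (S k))) μ)   ≡⟨ sumTo-cong N (λ k → coeff-hmode-scaleS m (c k) (S k) μ) ⟩
    sumTo N (λ k → c k * coeff (hmode m (S k)) μ)            ∎
    where open ≡-Reasoning

  h₋₁^ : ℕ → State
  h₋₁^ j = iterS j (hmode -[1+ 0 ]) vac

  h₋₁^-suc : ∀ j → h₋₁^ (suc j) ≡ (1ℚ , suc j ∷ []) ∷ []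
  h₋₁^-suc zero                       = refl
  h₋₁^-suc (suc j) rewrite h₋₁^-suc j = refl

  coeff-single : ∀ c e μ → coeff ((c , e) ∷ []) μ ≡ (if monoEq e μ then c else 0ℚ)
  coeff-single c e μ = trans (coeff-∷ c e [] μ) (+-identityʳ _)

  coeff-h₋₁^ : ∀ j μ → coeff (h₋₁^ j) μ ≡ (if monoEq (j ∷ []) μ then 1ℚ else 0ℚ)
  coeff-h₋₁^ zero    μ = trans (coeff-single 1ℚ [] μ) (cong (if_then 1ℚ else 0ℚ) (monoEq-[] μ))
    where
    monoEq-[] : ∀ μ → monoEq [] μ ≡ monoEq (0 ∷ []) μ
    monoEq-[] []       = refl
    monoEq-[] (b ∷ bs) = cong (_∧ monoEq [] bs) (sym (0≡ᵇ-sym b))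
  coeff-h₋₁^ (suc j) μ rewrite h₋₁^-suc j = coeff-single 1ℚ (suc j ∷ []) μ

  annihilated-term : ∀ b n → (if b then toQ n * toQ 0 * 1ℚ else 0ℚ) ≡ 0ℚ
  annihilated-term true  n = trans (cong (_* 1ℚ) (*-zeroʳ (toQ n))) (*-zeroˡ 1ℚ)
  annihilated-term false n = refl

  coeff-h₁-h₋₁^ : ∀ j μ → coeff (hmode (ℤ.+ 1) (h₋₁^ j)) μ ≡ toQ j * coeff (h₋₁^ (j ∸ 1)) μ
  coeff-h₁-h₋₁^ zero μ =
    trans (coeff-single (toQ 1 * toQ 0 * 1ℚ) [] μ) (trans (annihilated-term (monoEq [] μ) 1) (sym (*-zeroˡ (coeff vac μ))))
  coeff-h₁-h₋₁^ (suc j) μ rewrite h₋₁^-suc j = begin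
    coeff ((toQ 1 * toQ (suc j) * 1ℚ , j ∷ []) ∷ []) μ        ≡⟨ coeff-single (toQ 1 * toQ (suc j) * 1ℚ) (j ∷ []) μ ⟩
    (if monoEq (j ∷ []) μ then toQ 1 * toQ (suc j) * 1ℚ else 0ℚ) ≡⟨ cong (if monoEq (j ∷ []) μ then_else 0ℚ) (units (toQ (suc j))) ⟩
    (if monoEq (j ∷ []) μ then toQ (suc j) * 1ℚ else 0ℚ)       ≡⟨ if-*ˡ (monoEq (j ∷ []) μ) (toQ (suc j)) 1ℚ ⟩
    toQ (suc j) * (if monoEq (j ∷ []) μ then 1ℚ else 0ℚ)       ≡⟨ cong (toQ (suc j) *_) (coeff-h₋₁^ j μ) ⟨
    toQ (suc j) * coeff (h₋₁^ j) μ                            ∎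
    where
    open ≡-Reasoning
    units : ∀ x → toQ 1 * x * 1ℚ ≡ x * 1ℚ
    units = solve-∀ ℚ-ring

  coeff-h₂₊-h₋₁^ : ∀ i j μ → coeff (hmode (ℤ.+ suc (suc i)) (h₋₁^ j)) μ ≡ 0ℚ
  coeff-h₂₊-h₋₁^ i zero μ =
    trans (coeff-single _ (decAt (suc i) []) μ) (annihilated-term (monoEq (decAt (suc i) []) μ) (suc (suc i)))
  coeff-h₂₊-h₋₁^ i (suc j) μ rewrite h₋₁^-suc j =
    trans (coeff-single _ (decAt (suc i) (suc j ∷ [])) μ) (annihilated-term (monoEq (decAt (suc i) (suc j ∷ [])) μ) (suc (suc i)))

module SquareBracketModes where

  open FiniteSums
  open StateCoefficients
  open import Data.Rational using (_+_; _*_)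
  open import Data.Rational.Properties

  -[1+s]+d≡-[1+s∸d] : ∀ s d → d ≤ s → -[1+ s ] ℤ.+ ℤ.+ d ≡ -[1+ (s ∸ d) ]
  -[1+s]+d≡-[1+s∸d] s d d≤s = trans (ℤₚ.⊖-< (s≤s d≤s)) (cong (λ n → ℤ.- (ℤ.+ n)) (ℕₚ.+-∸-assoc 1 d≤s))

  -[1+s]+[1+s+j]≡j : ∀ s j → -[1+ s ] ℤ.+ ℤ.+ (suc s ℕ.+ j) ≡ ℤ.+ j
  -[1+s]+[1+s+j]≡j s j = trans (ℤₚ.⊖-≥ (ℕₚ.m≤m+n (suc s) j)) (cong ℤ.+_ (ℕₚ.m+n∸m≡n (suc s) j))

  -- Among the modes h(m), m ≥ -s-1, making up h[-s-1], only h(-s-1), …, h(-1) and h(1) survive on w; h(0) = 0.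
  hbracket-on-low-states : ∀ s v w → v ≈ w → (∀ i μ → coeff (hmode (ℤ.+ suc (suc i)) w) μ ≡ 0ℚ) → ∀ μ →
    coeff (hbracket -[1+ s ] v) μ
      ≡ sumTo s (λ n → bracketCoeff -[1+ s ] -[1+ n ] * coeff (hmode -[1+ n ] w) μ)
        + bracketCoeff -[1+ s ] (ℤ.+ 1) * coeff (hmode (ℤ.+ 1) w) μ
  hbracket-on-low-states s v w v≈w h₂₊w≡0 μ = begin
    coeff (hbracket n v) μ
      ≡⟨ coeff-sumSt D _ μ ⟩
    sumTo D (λ d → coeff (scaleS (bracketCoeff n (n ℤ.+ ℤ.+ d)) (hmode (n ℤ.+ ℤ.+ d) v)) μ)
      ≡⟨ sumTo-cong D (λ d → trans (coeff-scaleS (bracketCoeff n (n ℤ.+ ℤ.+ d)) (hmode (n ℤ.+ ℤ.+ d) v) μ)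
                                   (cong (bracketCoeff n (n ℤ.+ ℤ.+ d) *_) (hmode-cong (n ℤ.+ ℤ.+ d) {v} {w} v≈w μ))) ⟩
    sumTo D term
      ≡⟨ sumTo-extend (suc (suc s)) D term s+2≤D high-terms ⟩
    sumTo s term + term (suc s) + term (suc (suc s))
      ≡⟨ cong₂ _+_ (cong₂ _+_ (trans (sumTo-cong-≤ s negative-terms) (sym (sumTo-reverse s term′))) h₀-term) h₁-term ⟩
    sumTo s term′ + 0ℚ + bracketCoeff n (ℤ.+ 1) * coeff (hmode (ℤ.+ 1) w) μ
      ≡⟨ cong (_+ bracketCoeff n (ℤ.+ 1) * coeff (hmode (ℤ.+ 1) w) μ) (+-identityʳ (sumTo s term′)) ⟩
    sumTo s term′ + bracketCoeff n (ℤ.+ 1) * coeff (hmode (ℤ.+ 1) w) μ ∎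
    where
    open ≡-Reasoning
    n = -[1+ s ]
    D = suc s ℕ.+ maxLen v ℕ.+ 1
    term : ℕ → ℚ
    term d = bracketCoeff n (n ℤ.+ ℤ.+ d) * coeff (hmode (n ℤ.+ ℤ.+ d) w) μ
    term′ : ℕ → ℚ
    term′ m = bracketCoeff n -[1+ m ] * coeff (hmode -[1+ m ] w) μ
    s+2≤D : suc (suc s) ≤ D
    s+2≤D = ℕₚ.≤-trans (ℕₚ.≤-reflexive (ℕₚ.+-comm 1 (suc s))) (ℕₚ.+-monoˡ-≤ 1 (ℕₚ.m≤m+n (suc s) (maxLen v)))
    nonnegative-term : ∀ j → term (suc s ℕ.+ j) ≡ bracketCoeff n (ℤ.+ j) * coeff (hmode (ℤ.+ j) w) μ
    nonnegative-term j = cong (λ m → bracketCoeff n m * coeff (hmode m w) μ) (-[1+s]+[1+s+j]≡j s j)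
    negative-terms : ∀ d → d ≤ s → term d ≡ term′ (s ∸ d)
    negative-terms d d≤s = cong (λ m → bracketCoeff n m * coeff (hmode m w) μ) (-[1+s]+d≡-[1+s∸d] s d d≤s)
    h₀-term : term (suc s) ≡ 0ℚ
    h₀-term = trans (cong term (sym (ℕₚ.+-identityʳ (suc s)))) (trans (nonnegative-term 0) (*-zeroʳ (bracketCoeff n (ℤ.+ 0))))
    h₁-term : term (suc (suc s)) ≡ bracketCoeff n (ℤ.+ 1) * coeff (hmode (ℤ.+ 1) w) μ
    h₁-term = trans (cong term (sym (ℕₚ.+-comm (suc s) 1))) (nonnegative-term 1)
    high-terms : ∀ d → suc (suc s) < d → term d ≡ 0ℚ
    high-terms d s+2<d = begin
      term d                          ≡⟨ cong term (ℕₚ.m+[n∸m]≡n s+1≤d) ⟨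
      term (suc s ℕ.+ (d ∸ suc s))    ≡⟨ nonnegative-term (d ∸ suc s) ⟩
      bracketCoeff n (ℤ.+ (d ∸ suc s)) * coeff (hmode (ℤ.+ (d ∸ suc s)) w) μ
                                      ≡⟨ h₂₊-term (d ∸ suc s) (ℕₚ.m+n≤o⇒m≤o∸n 2 s+2<d) ⟩
      0ℚ                              ∎
      where
      s+1≤d : suc s ≤ d
      s+1≤d = ℕₚ.≤-trans (ℕₚ.n≤1+n (suc s)) (ℕₚ.<⇒≤ s+2<d)
      h₂₊-term : ∀ j → 2 ≤ j → bracketCoeff n (ℤ.+ j) * coeff (hmode (ℤ.+ j) w) μ ≡ 0ℚ
      h₂₊-term (suc zero)    (s≤s ())
      h₂₊-term (suc (suc i)) _ = trans (cong (bracketCoeff n (ℤ.+ suc (suc i)) *_) (h₂₊w≡0 i μ)) (*-zeroʳ (bracketCoeff n (ℤ.+ suc (suc i))))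

module BracketCoefficients where

  open RationalNumerals
  open PowerSeries
  open BernoulliSeries
  open StirlingSeries
  open import Data.Rational using (_+_; _*_; -_)

  bracketCoeff-neg : ∀ s n → n ≤ s → bracketCoeff -[1+ s ] -[1+ n ] ≡ mulSer expSer (powSer gSer n) (s ∸ n)
  bracketCoeff-neg s n n≤s with -[1+ n ] ℤ.- -[1+ s ] | ℤₚ.⊖-≥ (s≤s n≤s)
  ... | .(ℤ.+ (s ∸ n)) | refl = cong (λ k → mulSer expSer (powSerℤ gSer k) (s ∸ n)) (-[1+n]+1≡-n n)
    where
    -[1+n]+1≡-n : ∀ n → ℤ.- (ℤ.suc -[1+ n ]) ≡ ℤ.+ n
    -[1+n]+1≡-n zero    = refl
    -[1+n]+1≡-n (suc n) = refl

  n!*stirling≡s!*bracketCoeff : ∀ s n → n ≤ s → toQ (n !) * stirling (suc s) n ≡ toQ (s !) * bracketCoeff -[1+ s ] -[1+ n ]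
  n!*stirling≡s!*bracketCoeff s n n≤s = trans (stirling-from-series s n n≤s) (cong (toQ (s !) *_) (sym (bracketCoeff-neg s n n≤s)))

  -- bracketCoeff -[1+ s ] (+ 1) unfolds to the coefficient of z^(s+2) in e^z (invSer gSer)²
  s!*bracketCoeff-h₁ : ∀ s → toQ (s !) * bracketCoeff -[1+ s ] (ℤ.+ 1) ≡ - (bernoulli (suc s ℕ.+ 1) * (ℤ.+ 1 / suc (suc s)))
  s!*bracketCoeff-h₁ s = begin
    toQ (s !) * mulSer expSer (powSer (invSer gSer) 2) (suc (suc s))
      ≡⟨ cong (toQ (s !) *_) (trans (mulSer-congˡ expSer invSer-gSer² (suc (suc s))) (expSer-*-bernoulliSer² (suc (suc s)))) ⟩
    toQ (s !) * (B * I + - 1ℚ * (toQ (suc (suc s)) * (B * I)))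
      ≡⟨ cong (λ x → toQ (s !) * (B * I + - 1ℚ * (x * (B * I)))) (toQ-+ 1 (suc s)) ⟩
    toQ (s !) * (B * I + - 1ℚ * ((1ℚ + toQ (suc s)) * (B * I)))
      ≡⟨ collect (toQ (s !)) B I (toQ (suc s)) ⟩
    - (B * (I * (toQ (suc s) * toQ (s !))))
      ≡⟨ cong (λ x → - (B * (I * x))) (toQ-* (suc s) (s !)) ⟨
    - (B * (I * toQ (suc s !)))
      ≡⟨ cong (λ x → - (B * x)) (invFact-suc*n!≡1/[1+n] (suc s)) ⟩
    - (B * (ℤ.+ 1 / suc (suc s)))
      ≡⟨ cong (λ m → - (bernoulli m * (ℤ.+ 1 / suc (suc s)))) (sym (ℕₚ.+-comm (suc s) 1)) ⟩
    - (bernoulli (suc s ℕ.+ 1) * (ℤ.+ 1 / suc (suc s))) ∎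
    where
    open ≡-Reasoning
    B = bernoulli (suc (suc s))
    I = invFact (suc (suc s))
    collect : ∀ f b i n → f * (b * i + - 1ℚ * ((1ℚ + n) * (b * i))) ≡ - (b * (i * (n * f)))
    collect = solve-∀ ℚ-ring
    invSer-gSer² : powSer (invSer gSer) 2 ≗ mulSer bernoulliSer bernoulliSer
    invSer-gSer² k = trans (mulSer-congˡ (invSer gSer) (mulSer-identityʳ (invSer gSer)) k) (mulSer-cong invSer-gSer invSer-gSer k)

module HermiteExpansion where

  open RationalNumerals
  open FiniteSums
  open PowerSeries using (shiftSer; sumTo-shiftSer)
  open StateCoefficients
  open SquareBracketModes
  open import Data.Nat.Properties using (_!≢0)
  import Data.Nat.Tactic.RingSolver as ℕ-Solver
  open import Data.Nat.Combinatorics using (nCk+nC[k+1]≡[n+1]C[k+1])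
  open import Data.Nat.Combinatorics.Specification using (k>n⇒nCk≡0)
  open import Data.Rational using (_+_; _*_)
  open import Data.Rational.Properties
  open import Relation.Nullary using (yes; no)

  fallingFactorial : ℕ → ℕ → ℕ
  fallingFactorial t j = (t C j) ℕ.* j !

  fallingFactorial-suc : ∀ t j → fallingFactorial t (suc j) ≡ (t ∸ j) ℕ.* fallingFactorial t j
  fallingFactorial-suc t j with j ℕₚ.<? t
  ... | no j≮t = trans (cong (ℕ._* suc j !) (k>n⇒nCk≡0 (s≤s (ℕₚ.≮⇒≥ j≮t))))
                       (sym (cong (ℕ._* fallingFactorial t j) (ℕₚ.m≤n⇒m∸n≡0 (ℕₚ.≮⇒≥ j≮t))))
  ... | yes j<t = ℕₚ.*-cancelʳ-≡ _ _ ((t ∸ suc j) !) {{(t ∸ suc j) !≢0}} (begin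
    (t C suc j) ℕ.* suc j ! ℕ.* (t ∸ suc j) !
      ≡⟨ ℕₚ.*-assoc (t C suc j) (suc j !) ((t ∸ suc j) !) ⟩
    (t C suc j) ℕ.* (suc j ! ℕ.* (t ∸ suc j) !)
      ≡⟨ nCk*k![n∸k]!≡n! j<t ⟩
    t !
      ≡⟨ nCk*k![n∸k]!≡n! (ℕₚ.<⇒≤ j<t) ⟨
    (t C j) ℕ.* (j ! ℕ.* (t ∸ j) !)
      ≡⟨ cong (λ m → (t C j) ℕ.* (j ! ℕ.* m !)) t∸j≡1+[t∸1+j] ⟩
    (t C j) ℕ.* (j ! ℕ.* (suc (t ∸ suc j)) !)
      ≡⟨ regroup (t C j) (j !) (t ∸ suc j) ((t ∸ suc j) !) ⟩
    suc (t ∸ suc j) ℕ.* fallingFactorial t j ℕ.* (t ∸ suc j) !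
      ≡⟨ cong (λ m → m ℕ.* fallingFactorial t j ℕ.* (t ∸ suc j) !) t∸j≡1+[t∸1+j] ⟨
    (t ∸ j) ℕ.* fallingFactorial t j ℕ.* (t ∸ suc j) ! ∎)
    where
    open ≡-Reasoning
    t∸j≡1+[t∸1+j] : t ∸ j ≡ suc (t ∸ suc j)
    t∸j≡1+[t∸1+j] = ℕₚ.+-∸-assoc 1 {t} {suc j} j<t
    regroup : ∀ c f d g → c ℕ.* (f ℕ.* ((1 ℕ.+ d) ℕ.* g)) ≡ (1 ℕ.+ d) ℕ.* (c ℕ.* f) ℕ.* g
    regroup = ℕ-Solver.solve-∀

  fallingFactorial-pascal : ∀ t j → fallingFactorial (suc t) (suc j) ≡ fallingFactorial t (suc j) ℕ.+ suc j ℕ.* fallingFactorial t j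
  fallingFactorial-pascal t j = trans (cong (ℕ._* suc j !) (sym (nCk+nC[k+1]≡[n+1]C[k+1] t j)))
    (distribute (t C j) (t C suc j) (suc j) (j !))
    where
    distribute : ∀ a b n f → (a ℕ.+ b) ℕ.* (n ℕ.* f) ≡ b ℕ.* (n ℕ.* f) ℕ.+ n ℕ.* (a ℕ.* f)
    distribute = ℕ-Solver.solve-∀

  -- the coefficient of h(-1)^(t-2k) 1 in h[-1]^t 1
  hermiteCoeff : ℕ → ℕ → ℚ
  hermiteCoeff t k = toQ (t C (2 ℕ.* k)) * toQ ((2 ℕ.* k) !) * invFact k * powQ (-[1+ 0 ] / 24) k

  hermiteCoeff-falling : ∀ t k → hermiteCoeff t k ≡ toQ (fallingFactorial t (2 ℕ.* k)) * invFact k * powQ (-[1+ 0 ] / 24) k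
  hermiteCoeff-falling t k = cong (λ x → x * invFact k * powQ (-[1+ 0 ] / 24) k) (sym (toQ-* (t C (2 ℕ.* k)) ((2 ℕ.* k) !)))

  hermiteCoeff-vanishes : ∀ t k → t < 2 ℕ.* k → hermiteCoeff t k ≡ 0ℚ
  hermiteCoeff-vanishes t k t<2k rewrite k>n⇒nCk≡0 t<2k = zero-left (toQ ((2 ℕ.* k) !)) (invFact k) (powQ (-[1+ 0 ] / 24) k)
    where
    zero-left : ∀ a b c → 0ℚ * a * b * c ≡ 0ℚ
    zero-left = solve-∀ ℚ-ring

  hermiteCoeff-*-[t∸2k] : ∀ t k → hermiteCoeff t k * toQ (t ∸ 2 ℕ.* k)
                                 ≡ toQ (t C (2 ℕ.* k ℕ.+ 1)) * toQ ((2 ℕ.* k ℕ.+ 1) !) * invFact k * powQ (-[1+ 0 ] / 24) k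
  hermiteCoeff-*-[t∸2k] t k = begin
    hermiteCoeff t k * toQ (t ∸ 2 ℕ.* k)
      ≡⟨ cong (_* toQ (t ∸ 2 ℕ.* k)) (hermiteCoeff-falling t k) ⟩
    toQ (fallingFactorial t (2 ℕ.* k)) * invFact k * w^k * toQ (t ∸ 2 ℕ.* k)
      ≡⟨ rotate (toQ (fallingFactorial t (2 ℕ.* k))) (invFact k) w^k (toQ (t ∸ 2 ℕ.* k)) ⟩
    toQ (t ∸ 2 ℕ.* k) * toQ (fallingFactorial t (2 ℕ.* k)) * invFact k * w^k
      ≡⟨ cong (λ x → x * invFact k * w^k) (trans (sym (toQ-* (t ∸ 2 ℕ.* k) (fallingFactorial t (2 ℕ.* k)))) (cong toQ (sym (fallingFactorial-suc t (2 ℕ.* k))))) ⟩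
    toQ (fallingFactorial t (suc (2 ℕ.* k))) * invFact k * w^k
      ≡⟨ cong (λ j → toQ (fallingFactorial t j) * invFact k * w^k) (ℕₚ.+-comm 1 (2 ℕ.* k)) ⟩
    toQ (fallingFactorial t (2 ℕ.* k ℕ.+ 1)) * invFact k * w^k
      ≡⟨ cong (λ x → x * invFact k * w^k) (toQ-* (t C (2 ℕ.* k ℕ.+ 1)) ((2 ℕ.* k ℕ.+ 1) !)) ⟩
    toQ (t C (2 ℕ.* k ℕ.+ 1)) * toQ ((2 ℕ.* k ℕ.+ 1) !) * invFact k * w^k ∎
    where
    open ≡-Reasoning
    w^k = powQ (-[1+ 0 ] / 24) k
    rotate : ∀ f i w d → f * i * w * d ≡ d * f * i * w
    rotate = solve-∀ ℚ-ring

  -- the factor toQ 2 * (-1/24) is the coefficient bracketCoeff -[1+ 0 ] (+ 1) of h(1) in h[-1]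
  hermiteCoeff-recurrence : ∀ t k →
    hermiteCoeff t (suc k) + toQ 2 * (-[1+ 0 ] / 24) * hermiteCoeff t k * toQ (t ∸ 2 ℕ.* k) ≡ hermiteCoeff (suc t) (suc k)
  hermiteCoeff-recurrence t k = begin
    hermiteCoeff t (suc k) + toQ 2 * w * hermiteCoeff t k * D
      ≡⟨ cong₂ (λ x y → x + toQ 2 * w * y * D) (hermiteCoeff-falling t (suc k)) (hermiteCoeff-falling t k) ⟩
    A * I₁ * (w * wᵏ) + toQ 2 * w * (F * I₀ * wᵏ) * D
      ≡⟨ cong (λ x → A * I₁ * (w * wᵏ) + toQ 2 * w * (F * x * wᵏ) * D) (invFact-suc k) ⟨
    A * I₁ * (w * wᵏ) + toQ 2 * w * (F * (I₁ * toQ (suc k)) * wᵏ) * D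
      ≡⟨ collect A (toQ 2) (toQ (suc k)) D F I₁ w wᵏ ⟩
    (A + toQ 2 * toQ (suc k) * (D * F)) * I₁ * (w * wᵏ)
      ≡⟨ cong (λ x → x * I₁ * (w * wᵏ)) numerator ⟩
    toQ (fallingFactorial (suc t) (2 ℕ.* suc k)) * I₁ * (w * wᵏ)
      ≡⟨ hermiteCoeff-falling (suc t) (suc k) ⟨
    hermiteCoeff (suc t) (suc k) ∎
    where
    open ≡-Reasoning
    w  = -[1+ 0 ] / 24
    wᵏ = powQ w k
    A  = toQ (fallingFactorial t (2 ℕ.* suc k))
    F  = toQ (fallingFactorial t (2 ℕ.* k))
    D  = toQ (t ∸ 2 ℕ.* k)
    I₀ = invFact k
    I₁ = invFact (suc k)
    collect : ∀ A two n D F I w wᵏ → A * I * (w * wᵏ) + two * w * (F * (I * n) * wᵏ) * D ≡ (A + two * n * (D * F)) * I * (w * wᵏ)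
    collect = solve-∀ ℚ-ring
    2[1+k]≡2+2k : 2 ℕ.* suc k ≡ suc (suc (2 ℕ.* k))
    2[1+k]≡2+2k = ℕₚ.*-suc 2 k
    falling-numerator : fallingFactorial (suc t) (2 ℕ.* suc k)
                      ≡ fallingFactorial t (2 ℕ.* suc k) ℕ.+ 2 ℕ.* suc k ℕ.* ((t ∸ 2 ℕ.* k) ℕ.* fallingFactorial t (2 ℕ.* k))
    falling-numerator = begin
      fallingFactorial (suc t) (2 ℕ.* suc k)
        ≡⟨ cong (fallingFactorial (suc t)) 2[1+k]≡2+2k ⟩
      fallingFactorial (suc t) (suc (suc (2 ℕ.* k)))
        ≡⟨ fallingFactorial-pascal t (suc (2 ℕ.* k)) ⟩
      fallingFactorial t (suc (suc (2 ℕ.* k))) ℕ.+ suc (suc (2 ℕ.* k)) ℕ.* fallingFactorial t (suc (2 ℕ.* k))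
        ≡⟨ cong₂ (λ j x → fallingFactorial t j ℕ.+ j ℕ.* x) (sym 2[1+k]≡2+2k) (fallingFactorial-suc t (2 ℕ.* k)) ⟩
      fallingFactorial t (2 ℕ.* suc k) ℕ.+ 2 ℕ.* suc k ℕ.* ((t ∸ 2 ℕ.* k) ℕ.* fallingFactorial t (2 ℕ.* k)) ∎
    numerator : A + toQ 2 * toQ (suc k) * (D * F) ≡ toQ (fallingFactorial (suc t) (2 ℕ.* suc k))
    numerator = sym (begin
      toQ (fallingFactorial (suc t) (2 ℕ.* suc k))
        ≡⟨ cong toQ falling-numerator ⟩
      toQ (fallingFactorial t (2 ℕ.* suc k) ℕ.+ 2 ℕ.* suc k ℕ.* ((t ∸ 2 ℕ.* k) ℕ.* fallingFactorial t (2 ℕ.* k)))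
        ≡⟨ toQ-+ (fallingFactorial t (2 ℕ.* suc k)) (2 ℕ.* suc k ℕ.* ((t ∸ 2 ℕ.* k) ℕ.* fallingFactorial t (2 ℕ.* k))) ⟩
      A + toQ (2 ℕ.* suc k ℕ.* ((t ∸ 2 ℕ.* k) ℕ.* fallingFactorial t (2 ℕ.* k)))
        ≡⟨ cong (A +_) (trans (toQ-* (2 ℕ.* suc k) ((t ∸ 2 ℕ.* k) ℕ.* fallingFactorial t (2 ℕ.* k)))
                              (cong₂ _*_ (toQ-* 2 (suc k)) (toQ-* (t ∸ 2 ℕ.* k) (fallingFactorial t (2 ℕ.* k))))) ⟩
      A + toQ 2 * toQ (suc k) * (D * F) ∎)

  hermiteState : ℕ → ℕ → State
  hermiteState t N = sumSt N (λ k → scaleS (hermiteCoeff t k) (h₋₁^ (t ∸ 2 ℕ.* k)))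

  coeff-hermiteState : ∀ t N μ → coeff (hermiteState t N) μ ≡ sumTo N (λ k → hermiteCoeff t k * coeff (h₋₁^ (t ∸ 2 ℕ.* k)) μ)
  coeff-hermiteState t N μ = trans (coeff-sumSt N _ μ) (sumTo-cong N (λ k → coeff-scaleS (hermiteCoeff t k) (h₋₁^ (t ∸ 2 ℕ.* k)) μ))

  coeff-h₂₊-hermiteState : ∀ t N i μ → coeff (hmode (ℤ.+ suc (suc i)) (hermiteState t N)) μ ≡ 0ℚ
  coeff-h₂₊-hermiteState t N i μ = trans (coeff-hmode-lincomb (ℤ.+ suc (suc i)) N (hermiteCoeff t) (λ k → h₋₁^ (t ∸ 2 ℕ.* k)) μ)
    (sumTo-zero N _ (λ k _ → trans (cong (hermiteCoeff t k *_) (coeff-h₂₊-h₋₁^ i (t ∸ 2 ℕ.* k) μ)) (*-zeroʳ (hermiteCoeff t k))))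

  coeff-h₁-hermiteState : ∀ t N μ →
    coeff (hmode (ℤ.+ 1) (hermiteState t N)) μ ≡ sumTo N (λ k → hermiteCoeff t k * (toQ (t ∸ 2 ℕ.* k) * coeff (h₋₁^ (t ∸ 2 ℕ.* k ∸ 1)) μ))
  coeff-h₁-hermiteState t N μ = trans (coeff-hmode-lincomb (ℤ.+ 1) N (hermiteCoeff t) (λ k → h₋₁^ (t ∸ 2 ℕ.* k)) μ)
    (sumTo-cong N (λ k → cong (hermiteCoeff t k *_) (coeff-h₁-h₋₁^ (t ∸ 2 ℕ.* k) μ)))

  -- where 2k > t both sides vanish, so the truncated subtraction is harmless
  coeff-h₋₁-hermiteState : ∀ t N μ →
    coeff (hmode -[1+ 0 ] (hermiteState t N)) μ ≡ sumTo N (λ k → hermiteCoeff t k * coeff (h₋₁^ (suc t ∸ 2 ℕ.* k)) μ)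
  coeff-h₋₁-hermiteState t N μ = trans (coeff-hmode-lincomb -[1+ 0 ] N (hermiteCoeff t) (λ k → h₋₁^ (t ∸ 2 ℕ.* k)) μ)
    (sumTo-cong N raise)
    where
    raise : ∀ k → hermiteCoeff t k * coeff (h₋₁^ (suc (t ∸ 2 ℕ.* k))) μ ≡ hermiteCoeff t k * coeff (h₋₁^ (suc t ∸ 2 ℕ.* k)) μ
    raise k with 2 ℕ.* k ℕₚ.≤? t
    ... | yes 2k≤t = cong (λ j → hermiteCoeff t k * coeff (h₋₁^ j) μ) (sym (ℕₚ.+-∸-assoc 1 2k≤t))
    ... | no  2k≰t rewrite hermiteCoeff-vanishes t k (ℕₚ.≰⇒> 2k≰t) =
      trans (*-zeroˡ (coeff (h₋₁^ (suc (t ∸ 2 ℕ.* k))) μ)) (sym (*-zeroˡ (coeff (h₋₁^ (suc t ∸ 2 ℕ.* k)) μ)))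

  hermiteState-step : ∀ t N μ → t ≤ N →
    coeff (hmode -[1+ 0 ] (hermiteState t N)) μ + toQ 2 * (-[1+ 0 ] / 24) * coeff (hmode (ℤ.+ 1) (hermiteState t N)) μ
    ≡ coeff (hermiteState (suc t) N) μ
  hermiteState-step t N μ t≤N = begin
    coeff (hmode -[1+ 0 ] (hermiteState t N)) μ + c * coeff (hmode (ℤ.+ 1) (hermiteState t N)) μ
      ≡⟨ cong₂ (λ x y → x + c * y) (coeff-h₋₁-hermiteState t N μ) (coeff-h₁-hermiteState t N μ) ⟩
    sumTo N (λ k → hermiteCoeff t k * x (suc t ∸ 2 ℕ.* k)) + c * sumTo N lowered
      ≡⟨ cong (sumTo N (λ k → hermiteCoeff t k * x (suc t ∸ 2 ℕ.* k)) +_)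
              (trans (sym (sumTo-*ˡ N c lowered)) (sym (sumTo-shiftSer N (λ k → c * lowered k) lowered-N≡0))) ⟩
    sumTo N (λ k → hermiteCoeff t k * x (suc t ∸ 2 ℕ.* k)) + sumTo N (shiftSer (λ k → c * lowered k))
      ≡⟨ sumTo-+ N _ (shiftSer (λ k → c * lowered k)) ⟨
    sumTo N (λ k → hermiteCoeff t k * x (suc t ∸ 2 ℕ.* k) + shiftSer (λ k → c * lowered k) k)
      ≡⟨ sumTo-cong N combine ⟩
    sumTo N (λ k → hermiteCoeff (suc t) k * x (suc t ∸ 2 ℕ.* k))
      ≡⟨ coeff-hermiteState (suc t) N μ ⟨
    coeff (hermiteState (suc t) N) μ ∎
    where
    open ≡-Reasoning
    c = toQ 2 * (-[1+ 0 ] / 24)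
    x : ℕ → ℚ
    x j = coeff (h₋₁^ j) μ
    lowered : ℕ → ℚ
    lowered k = hermiteCoeff t k * (toQ (t ∸ 2 ℕ.* k) * x (t ∸ 2 ℕ.* k ∸ 1))
    lowered-N≡0 : c * lowered N ≡ 0ℚ
    lowered-N≡0 = trans (cong (λ d → c * (hermiteCoeff t N * (toQ d * x (d ∸ 1)))) (ℕₚ.m≤n⇒m∸n≡0 (ℕₚ.≤-trans t≤N (ℕₚ.m≤n*m N 2))))
                        (annihilate c (hermiteCoeff t N) (x 0))
      where
      annihilate : ∀ c a y → c * (a * (toQ 0 * y)) ≡ 0ℚ
      annihilate = solve-∀ ℚ-ring
    t∸2k∸1≡1+t∸2[1+k] : ∀ k → t ∸ 2 ℕ.* k ∸ 1 ≡ suc t ∸ 2 ℕ.* suc k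
    t∸2k∸1≡1+t∸2[1+k] k = trans (ℕₚ.∸-+-assoc t (2 ℕ.* k) 1) (trans (cong (t ∸_) (ℕₚ.+-comm (2 ℕ.* k) 1)) (cong (suc t ∸_) (sym (ℕₚ.*-suc 2 k))))
    factor : ∀ p c q r z → p * z + c * (q * (r * z)) ≡ (p + c * q * r) * z
    factor = solve-∀ ℚ-ring
    combine : ∀ k → hermiteCoeff t k * x (suc t ∸ 2 ℕ.* k) + shiftSer (λ k → c * lowered k) k ≡ hermiteCoeff (suc t) k * x (suc t ∸ 2 ℕ.* k)
    combine zero    = +-identityʳ _
    combine (suc k) = begin
      hermiteCoeff t (suc k) * y + c * (hermiteCoeff t k * (toQ (t ∸ 2 ℕ.* k) * x (t ∸ 2 ℕ.* k ∸ 1)))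
        ≡⟨ cong (λ j → hermiteCoeff t (suc k) * y + c * (hermiteCoeff t k * (toQ (t ∸ 2 ℕ.* k) * x j))) (t∸2k∸1≡1+t∸2[1+k] k) ⟩
      hermiteCoeff t (suc k) * y + c * (hermiteCoeff t k * (toQ (t ∸ 2 ℕ.* k) * y))
        ≡⟨ factor (hermiteCoeff t (suc k)) c (hermiteCoeff t k) (toQ (t ∸ 2 ℕ.* k)) y ⟩
      (hermiteCoeff t (suc k) + c * hermiteCoeff t k * toQ (t ∸ 2 ℕ.* k)) * y
        ≡⟨ cong (_* y) (hermiteCoeff-recurrence t k) ⟩
      hermiteCoeff (suc t) (suc k) * y ∎
      where
      y = x (suc t ∸ 2 ℕ.* suc k)

  hbracket₋₁^≈hermiteState : ∀ t N → t ≤ N → iterS t (hbracket -[1+ 0 ]) vac ≈ hermiteState t N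
  hbracket₋₁^≈hermiteState zero N _ μ = sym (begin
    coeff (hermiteState 0 N) μ                                 ≡⟨ coeff-hermiteState 0 N μ ⟩
    sumTo N (λ k → hermiteCoeff 0 k * coeff (h₋₁^ (0 ∸ 2 ℕ.* k)) μ) ≡⟨ sumTo-extend 0 N _ z≤n beyond-0 ⟩
    1ℚ * coeff vac μ                                           ≡⟨ *-identityˡ (coeff vac μ) ⟩
    coeff vac μ                                                ∎)
    where
    open ≡-Reasoning
    beyond-0 : ∀ k → 0 < k → hermiteCoeff 0 k * coeff (h₋₁^ (0 ∸ 2 ℕ.* k)) μ ≡ 0ℚ
    beyond-0 k 0<k = trans (cong (_* coeff (h₋₁^ (0 ∸ 2 ℕ.* k)) μ) (hermiteCoeff-vanishes 0 k (ℕₚ.<-≤-trans 0<k (ℕₚ.m≤n*m k 2))))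
                           (*-zeroˡ (coeff (h₋₁^ (0 ∸ 2 ℕ.* k)) μ))
  hbracket₋₁^≈hermiteState (suc t) N 1+t≤N μ = begin
    coeff (hbracket -[1+ 0 ] (iterS t (hbracket -[1+ 0 ]) vac)) μ
      ≡⟨ hbracket-on-low-states 0 (iterS t (hbracket -[1+ 0 ]) vac) (hermiteState t N) (hbracket₋₁^≈hermiteState t N t≤N) (coeff-h₂₊-hermiteState t N) μ ⟩
    1ℚ * coeff (hmode -[1+ 0 ] (hermiteState t N)) μ + toQ 2 * (-[1+ 0 ] / 24) * coeff (hmode (ℤ.+ 1) (hermiteState t N)) μ
      ≡⟨ cong (_+ toQ 2 * (-[1+ 0 ] / 24) * coeff (hmode (ℤ.+ 1) (hermiteState t N)) μ) (*-identityˡ (coeff (hmode -[1+ 0 ] (hermiteState t N)) μ)) ⟩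
    coeff (hmode -[1+ 0 ] (hermiteState t N)) μ + toQ 2 * (-[1+ 0 ] / 24) * coeff (hmode (ℤ.+ 1) (hermiteState t N)) μ
      ≡⟨ hermiteState-step t N μ t≤N ⟩
    coeff (hermiteState (suc t) N) μ ∎
    where
    open ≡-Reasoning
    t≤N = ℕₚ.≤-trans (ℕₚ.n≤1+n t) 1+t≤N

module ExpansionCoefficients where

  open RationalNumerals
  open FiniteSums
  open StateCoefficients
  open SquareBracketModes
  open BracketCoefficients
  open StirlingSeries using (stirling-vanishes)
  open HermiteExpansion
  open import Data.Rational using (_+_; _*_; -_)
  open import Data.Rational.Properties

  stirlingSum≡s!*bracketSum : ∀ s N (y : ℕ → ℚ) → s ≤ N →
    sumTo N (λ n → toQ (n !) * stirling (suc s) n * y n) ≡ toQ (s !) * sumTo s (λ n → bracketCoeff -[1+ s ] -[1+ n ] * y n)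
  stirlingSum≡s!*bracketSum s N y s≤N = begin
    sumTo N (λ n → toQ (n !) * stirling (suc s) n * y n)
      ≡⟨ sumTo-extend s N _ s≤N (λ n s<n → trans (cong (_* y n) (stirling-vanishes s n s<n)) (*-zeroˡ (y n))) ⟩
    sumTo s (λ n → toQ (n !) * stirling (suc s) n * y n)
      ≡⟨ sumTo-cong-≤ s (λ n n≤s → trans (cong (_* y n) (n!*stirling≡s!*bracketCoeff s n n≤s))
                                         (*-assoc (toQ (s !)) (bracketCoeff -[1+ s ] -[1+ n ]) (y n))) ⟩
    sumTo s (λ n → toQ (s !) * (bracketCoeff -[1+ s ] -[1+ n ] * y n))
      ≡⟨ sumTo-*ˡ s (toQ (s !)) _ ⟩
    toQ (s !) * sumTo s (λ n → bracketCoeff -[1+ s ] -[1+ n ] * y n) ∎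
    where open ≡-Reasoning

  coeff-stirlingSide : ∀ r t N μ →
    coeff (sumSt N (λ n → sumSt N (λ k →
             scaleS (toQ (t C (2 ℕ.* k)) * toQ (n !) * stirling r n * toQ ((2 ℕ.* k) !) * invFact k * powQ (-[1+ 0 ] / 24) k)
                    (hmode -[1+ n ] (h₋₁^ (t ∸ 2 ℕ.* k)))))) μ
    ≡ sumTo N (λ n → toQ (n !) * stirling r n * coeff (hmode -[1+ n ] (hermiteState t N)) μ)
  coeff-stirlingSide r t N μ = trans (coeff-sumSt N _ μ) (sumTo-cong N (λ n → begin
    coeff (sumSt N (λ k → scaleS (α n k) (hmode -[1+ n ] (h₋₁^ (t ∸ 2 ℕ.* k))))) μ
      ≡⟨ coeff-sumSt N _ μ ⟩
    sumTo N (λ k → coeff (scaleS (α n k) (hmode -[1+ n ] (h₋₁^ (t ∸ 2 ℕ.* k)))) μ)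
      ≡⟨ sumTo-cong N (λ k → trans (coeff-scaleS (α n k) (hmode -[1+ n ] (h₋₁^ (t ∸ 2 ℕ.* k))) μ)
                                   (regroup n k (coeff (hmode -[1+ n ] (h₋₁^ (t ∸ 2 ℕ.* k))) μ))) ⟩
    sumTo N (λ k → toQ (n !) * stirling r n * (hermiteCoeff t k * coeff (hmode -[1+ n ] (h₋₁^ (t ∸ 2 ℕ.* k))) μ))
      ≡⟨ sumTo-*ˡ N (toQ (n !) * stirling r n) _ ⟩
    toQ (n !) * stirling r n * sumTo N (λ k → hermiteCoeff t k * coeff (hmode -[1+ n ] (h₋₁^ (t ∸ 2 ℕ.* k))) μ)
      ≡⟨ cong (toQ (n !) * stirling r n *_) (coeff-hmode-lincomb -[1+ n ] N (hermiteCoeff t) (λ k → h₋₁^ (t ∸ 2 ℕ.* k)) μ) ⟨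
    toQ (n !) * stirling r n * coeff (hmode -[1+ n ] (hermiteState t N)) μ ∎))
    where
    open ≡-Reasoning
    α : ℕ → ℕ → ℚ
    α n k = toQ (t C (2 ℕ.* k)) * toQ (n !) * stirling r n * toQ ((2 ℕ.* k) !) * invFact k * powQ (-[1+ 0 ] / 24) k
    shuffle : ∀ c f st f₂ i w y → c * f * st * f₂ * i * w * y ≡ f * st * (c * f₂ * i * w * y)
    shuffle = solve-∀ ℚ-ring
    regroup : ∀ n k y → α n k * y ≡ toQ (n !) * stirling r n * (hermiteCoeff t k * y)
    regroup n k y = shuffle (toQ (t C (2 ℕ.* k))) (toQ (n !)) (stirling r n) (toQ ((2 ℕ.* k) !)) (invFact k) (powQ (-[1+ 0 ] / 24) k) y

  coeff-bernoulliSide : ∀ s t N μ →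
    - coeff (sumSt N (λ k →
               scaleS (toQ (t C (2 ℕ.* k ℕ.+ 1)) * bernoulli (suc s ℕ.+ 1) * toQ ((2 ℕ.* k ℕ.+ 1) !) * invFact k
                         * (ℤ.+ 1 / suc (suc s)) * powQ (-[1+ 0 ] / 24) k)
                      (h₋₁^ (t ∸ (2 ℕ.* k ℕ.+ 1))))) μ
    ≡ toQ (s !) * (bracketCoeff -[1+ s ] (ℤ.+ 1) * coeff (hmode (ℤ.+ 1) (hermiteState t N)) μ)
  coeff-bernoulliSide s t N μ = begin
    - coeff (sumSt N (λ k → scaleS (γ k) (h₋₁^ (t ∸ (2 ℕ.* k ℕ.+ 1))))) μ
      ≡⟨ cong -_ (trans (coeff-sumSt N _ μ) (sumTo-cong N (λ k → coeff-scaleS (γ k) (h₋₁^ (t ∸ (2 ℕ.* k ℕ.+ 1))) μ))) ⟩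
    - sumTo N (λ k → γ k * x (t ∸ (2 ℕ.* k ℕ.+ 1)))
      ≡⟨ sumTo-neg N _ ⟨
    sumTo N (λ k → - (γ k * x (t ∸ (2 ℕ.* k ℕ.+ 1))))
      ≡⟨ sumTo-cong N lowered-term ⟨
    sumTo N (λ k → κ * (hermiteCoeff t k * (toQ (t ∸ 2 ℕ.* k) * x (t ∸ 2 ℕ.* k ∸ 1))))
      ≡⟨ sumTo-*ˡ N κ _ ⟩
    κ * sumTo N (λ k → hermiteCoeff t k * (toQ (t ∸ 2 ℕ.* k) * x (t ∸ 2 ℕ.* k ∸ 1)))
      ≡⟨ cong (κ *_) (coeff-h₁-hermiteState t N μ) ⟨
    κ * coeff (hmode (ℤ.+ 1) (hermiteState t N)) μ
      ≡⟨ cong (_* coeff (hmode (ℤ.+ 1) (hermiteState t N)) μ) (s!*bracketCoeff-h₁ s) ⟨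
    toQ (s !) * bracketCoeff -[1+ s ] (ℤ.+ 1) * coeff (hmode (ℤ.+ 1) (hermiteState t N)) μ
      ≡⟨ *-assoc (toQ (s !)) (bracketCoeff -[1+ s ] (ℤ.+ 1)) _ ⟩
    toQ (s !) * (bracketCoeff -[1+ s ] (ℤ.+ 1) * coeff (hmode (ℤ.+ 1) (hermiteState t N)) μ) ∎
    where
    open ≡-Reasoning
    x : ℕ → ℚ
    x j = coeff (h₋₁^ j) μ
    γ : ℕ → ℚ
    γ k = toQ (t C (2 ℕ.* k ℕ.+ 1)) * bernoulli (suc s ℕ.+ 1) * toQ ((2 ℕ.* k ℕ.+ 1) !) * invFact k
            * (ℤ.+ 1 / suc (suc s)) * powQ (-[1+ 0 ] / 24) k
    κ = - (bernoulli (suc s ℕ.+ 1) * (ℤ.+ 1 / suc (suc s)))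
    shuffle : ∀ B R C f i w y → - (B * R) * (C * f * i * w * y) ≡ - (C * B * f * i * R * w * y)
    shuffle = solve-∀ ℚ-ring
    lowered-term : ∀ k → κ * (hermiteCoeff t k * (toQ (t ∸ 2 ℕ.* k) * x (t ∸ 2 ℕ.* k ∸ 1))) ≡ - (γ k * x (t ∸ (2 ℕ.* k ℕ.+ 1)))
    lowered-term k = begin
      κ * (hermiteCoeff t k * (toQ (t ∸ 2 ℕ.* k) * x (t ∸ 2 ℕ.* k ∸ 1)))
        ≡⟨ cong (λ j → κ * (hermiteCoeff t k * (toQ (t ∸ 2 ℕ.* k) * x j))) (ℕₚ.∸-+-assoc t (2 ℕ.* k) 1) ⟩
      κ * (hermiteCoeff t k * (toQ (t ∸ 2 ℕ.* k) * y))
        ≡⟨ cong (κ *_) (*-assoc (hermiteCoeff t k) (toQ (t ∸ 2 ℕ.* k)) y) ⟨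
      κ * (hermiteCoeff t k * toQ (t ∸ 2 ℕ.* k) * y)
        ≡⟨ cong (λ c → κ * (c * y)) (hermiteCoeff-*-[t∸2k] t k) ⟩
      κ * (toQ (t C (2 ℕ.* k ℕ.+ 1)) * toQ ((2 ℕ.* k ℕ.+ 1) !) * invFact k * powQ (-[1+ 0 ] / 24) k * y)
        ≡⟨ shuffle (bernoulli (suc s ℕ.+ 1)) (ℤ.+ 1 / suc (suc s)) (toQ (t C (2 ℕ.* k ℕ.+ 1))) (toQ ((2 ℕ.* k ℕ.+ 1) !))
                   (invFact k) (powQ (-[1+ 0 ] / 24) k) y ⟩
      - (γ k * y) ∎
      where
      y = x (t ∸ (2 ℕ.* k ℕ.+ 1))

  coeff-hbracket-on-hbracket₋₁^ : ∀ s t N μ → t ≤ N →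
    coeff (scaleS (toQ (s !)) (hbracket -[1+ s ] (iterS t (hbracket -[1+ 0 ]) vac))) μ
    ≡ toQ (s !) * (sumTo s (λ n → bracketCoeff -[1+ s ] -[1+ n ] * coeff (hmode -[1+ n ] (hermiteState t N)) μ)
                   + bracketCoeff -[1+ s ] (ℤ.+ 1) * coeff (hmode (ℤ.+ 1) (hermiteState t N)) μ)
  coeff-hbracket-on-hbracket₋₁^ s t N μ t≤N =
    trans (coeff-scaleS (toQ (s !)) (hbracket -[1+ s ] h[-1]ᵗ) μ)
          (cong (toQ (s !) *_) (hbracket-on-low-states s h[-1]ᵗ (hermiteState t N) (hbracket₋₁^≈hermiteState t N t≤N) (coeff-h₂₊-hermiteState t N) μ))
    where
    h[-1]ᵗ = iterS t (hbracket -[1+ 0 ]) vac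

  coeff-stirling-bernoulli-expansion : ∀ s t N μ → s ≤ N →
    coeff (sumSt N (λ n → sumSt N (λ k →
             scaleS (toQ (t C (2 ℕ.* k)) * toQ (n !) * stirling (suc s) n * toQ ((2 ℕ.* k) !) * invFact k * powQ (-[1+ 0 ] / 24) k)
                    (hmode -[1+ n ] (h₋₁^ (t ∸ 2 ℕ.* k)))))
           +S negS (sumSt N (λ k →
             scaleS (toQ (t C (2 ℕ.* k ℕ.+ 1)) * bernoulli (suc s ℕ.+ 1) * toQ ((2 ℕ.* k ℕ.+ 1) !) * invFact k
                       * (ℤ.+ 1 / suc (suc s)) * powQ (-[1+ 0 ] / 24) k)
                    (h₋₁^ (t ∸ (2 ℕ.* k ℕ.+ 1)))))) μ
    ≡ toQ (s !) * (sumTo s (λ n → bracketCoeff -[1+ s ] -[1+ n ] * coeff (hmode -[1+ n ] (hermiteState t N)) μ)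
                   + bracketCoeff -[1+ s ] (ℤ.+ 1) * coeff (hmode (ℤ.+ 1) (hermiteState t N)) μ)
  coeff-stirling-bernoulli-expansion s t N μ s≤N = begin
    coeff (stirlingSide +S negS bernoulliSide) μ
      ≡⟨ coeff-++ stirlingSide (negS bernoulliSide) μ ⟩
    coeff stirlingSide μ + coeff (negS bernoulliSide) μ
      ≡⟨ cong₂ _+_ (trans (coeff-stirlingSide (suc s) t N μ) (stirlingSum≡s!*bracketSum s N (λ n → coeff (hmode -[1+ n ] (hermiteState t N)) μ) s≤N))
                   (trans (coeff-negS bernoulliSide μ) (coeff-bernoulliSide s t N μ)) ⟩
    toQ (s !) * sumTo s (λ n → bracketCoeff -[1+ s ] -[1+ n ] * coeff (hmode -[1+ n ] (hermiteState t N)) μ)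
      + toQ (s !) * (bracketCoeff -[1+ s ] (ℤ.+ 1) * coeff (hmode (ℤ.+ 1) (hermiteState t N)) μ)
      ≡⟨ *-distribˡ-+ (toQ (s !)) _ _ ⟨
    toQ (s !) * (sumTo s (λ n → bracketCoeff -[1+ s ] -[1+ n ] * coeff (hmode -[1+ n ] (hermiteState t N)) μ)
                 + bracketCoeff -[1+ s ] (ℤ.+ 1) * coeff (hmode (ℤ.+ 1) (hermiteState t N)) μ) ∎
    where
    open ≡-Reasoning
    stirlingSide = sumSt N (λ n → sumSt N (λ k →
             scaleS (toQ (t C (2 ℕ.* k)) * toQ (n !) * stirling (suc s) n * toQ ((2 ℕ.* k) !) * invFact k * powQ (-[1+ 0 ] / 24) k)
                    (hmode -[1+ n ] (h₋₁^ (t ∸ 2 ℕ.* k)))))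
    bernoulliSide = sumSt N (λ k →
             scaleS (toQ (t C (2 ℕ.* k ℕ.+ 1)) * bernoulli (suc s ℕ.+ 1) * toQ ((2 ℕ.* k ℕ.+ 1) !) * invFact k
                       * (ℤ.+ 1 / suc (suc s)) * powQ (-[1+ 0 ] / 24) k)
                    (h₋₁^ (t ∸ (2 ℕ.* k ℕ.+ 1))))

open import Data.Nat using (_+_; _*_; _%_)
open import Data.Integer using (+_)
open import Data.Rational using () renaming (_*_ to _*q_)
open import Data.Product using (∃; _,_)
open ExpansionCoefficients using (coeff-hbracket-on-hbracket₋₁^; coeff-stirling-bernoulli-expansion)

proposition3p4 : ∀ (r t : ℕ) → r % 2 ≡ 1 → t % 2 ≡ 1 →
  ∃ λ N₀ → ∀ N → N₀ ≤ N →
    scaleS (toQ ((r ∸ 1) !)) (hbracket -[1+ r ∸ 1 ] (iterS t (hbracket -[1+ 0 ]) vac))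
    ≈
    sumSt N (λ n → sumSt N (λ k →
        scaleS (toQ (t C (2 * k)) *q toQ (n !) *q stirling r n *q toQ ((2 * k) !)
                  *q invFact k *q powQ (-[1+ 0 ] / 24) k)
               (hmode -[1+ n ] (iterS (t ∸ 2 * k) (hmode -[1+ 0 ]) vac))))
    +S negS (sumSt N (λ k →
        scaleS (toQ (t C (2 * k + 1)) *q bernoulli (r + 1) *q toQ ((2 * k + 1) !)
                  *q invFact k *q (+ 1 / suc r) *q powQ (-[1+ 0 ] / 24) k)
               (iterS (t ∸ (2 * k + 1)) (hmode -[1+ 0 ]) vac)))
proposition3p4 0       t () _
proposition3p4 (suc s) t _  _ = t + suc s , λ N t+r≤N μ →
  trans (coeff-hbracket-on-hbracket₋₁^ s t N μ (ℕₚ.m+n≤o⇒m≤o t t+r≤N))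
        (sym (coeff-stirling-bernoulli-expansion s t N μ (ℕₚ.<⇒≤ (ℕₚ.m+n≤o⇒n≤o t t+r≤N))))
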